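{- Let $u=(a,b,c)$ and $v=(a',b',c')$ be vectors in $\mathbb Z^3$ with $a^2+b^2+c^2=a'^2+b'^2+c'^2=\ell>0$, $aa'+bb'+cc'=0$, and $\gcd(a,b,c,a',b',c')=1$. Let $d=\gcd(a,b,c)$, $d'=\gcd(a',b',c')$ and $D=\gcd(bc'-b'c,\ ac'-a'c,\ ab'-a'b)$. Let $S$ be the lattice square with vertices $0,u,v,u+v$. Then its Ehrhart polynomial is $$E_S(t)=Dt^2+(d+d')t+1,$$ i.e. $\#(tS\cap\mathbb Z^3)=Dt^2+(d+d')t+1$ for all $t\in\mathbb N$.
   Context: For a lattice polytope $P\subset\mathbb R^n$ (vertices in $\mathbb Z^n$), its Ehrhart polynomial $E_P(t)$ is the polynomial satisfying $E_P(t)=\#(tP\cap\mathbb Z^n)$ for all positive integers $t$, where $tP=\{tx:x\in P\}$. -}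

module Defs where

open import Data.Nat as ℕ using (ℕ)
open import Data.Nat.GCD using (gcd)
open import Data.Integer as ℤ using (ℤ; +_; ∣_∣)
open import Data.Rational as ℚ using (ℚ; _/_; 0ℚ; 1ℚ; _≤_)
open import Data.Product using (Σ; ∃; _×_; _,_)
open import Data.List using (List; length)
open import Data.List.Membership.Propositional using (_∈_)
open import Data.List.Relation.Unary.Unique.Propositional using (Unique)
open import Relation.Binary.PropositionalEquality using (_≡_)
open import Function.Bundles using (_⇔_)

ℤ³ : Set
ℤ³ = ℤ × ℤ × ℤ

ℚ³ : Set
ℚ³ = ℚ × ℚ × ℚ

toℚ : ℤ → ℚ
toℚ z = z / 1

ι : ℤ³ → ℚ³
ι (x , y , z) = toℚ x , toℚ y , toℚ z

_+³_ : ℤ³ → ℤ³ → ℤ³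
(x , y , z) +³ (x' , y' , z') = (x ℤ.+ x') , (y ℤ.+ y') , (z ℤ.+ z')

_⊕_ : ℚ³ → ℚ³ → ℚ³
(x , y , z) ⊕ (x' , y' , z') = (x ℚ.+ x') , (y ℚ.+ y') , (z ℚ.+ z')

_⊙_ : ℚ → ℚ³ → ℚ³
s ⊙ (x , y , z) = (s ℚ.* x) , (s ℚ.* y) , (s ℚ.* z)

dot : ℤ³ → ℤ³ → ℤ
dot (a , b , c) (a' , b' , c') = a ℤ.* a' ℤ.+ b ℤ.* b' ℤ.+ c ℤ.* c'

cross : ℤ³ → ℤ³ → ℤ³
cross (a , b , c) (a' , b' , c') =
  (b ℤ.* c' ℤ.- b' ℤ.* c) , (a ℤ.* c' ℤ.- a' ℤ.* c) , (a ℤ.* b' ℤ.- a' ℤ.* b)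

gcd³ : ℤ³ → ℕ
gcd³ (a , b , c) = gcd ∣ a ∣ (gcd ∣ b ∣ ∣ c ∣)

gcd⁶ : ℤ³ → ℤ³ → ℕ
gcd⁶ u v = gcd (gcd³ u) (gcd³ v)

-- p lies in the convex hull of the four points q₀ q₁ q₂ q₃
-- (convex combination with rational weights; since all data are rational,
--  this agrees with the real convex hull on rational points)
InConv4 : ℚ³ → ℚ³ → ℚ³ → ℚ³ → ℚ³ → Set
InConv4 q₀ q₁ q₂ q₃ p =
  Σ ℚ λ λ₀ → Σ ℚ λ λ₁ → Σ ℚ λ λ₂ → Σ ℚ λ λ₃ →
    (0ℚ ≤ λ₀) × (0ℚ ≤ λ₁) × (0ℚ ≤ λ₂) × (0ℚ ≤ λ₃) ×
    (λ₀ ℚ.+ λ₁ ℚ.+ λ₂ ℚ.+ λ₃ ≡ 1ℚ) ×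
    (p ≡ (λ₀ ⊙ q₀) ⊕ ((λ₁ ⊙ q₁) ⊕ ((λ₂ ⊙ q₂) ⊕ (λ₃ ⊙ q₃))))

InSquare : ℤ³ → ℤ³ → ℚ³ → Set
InSquare u v = InConv4 (ι (+ 0 , + 0 , + 0)) (ι u) (ι v) (ι (u +³ v))

InDilate : ℕ → (ℚ³ → Set) → ℚ³ → Set
InDilate t P p = Σ ℚ³ λ y → P y × (p ≡ ((+ t / 1) ⊙ y))

HasCard : (ℤ³ → Set) → ℕ → Set
HasCard P n = Σ (List ℤ³) λ xs → Unique xs × (∀ x → (x ∈ xs) ⇔ P x) × (length xs ≡ n)

LatticeCount : (ℚ³ → Set) → ℕ → ℕ → Set
LatticeCount P t n = HasCard (λ x → InDilate t P (ι x)) n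

-- A lattice point x of tS lies in the plane of u and v, and since u ⊥ v and |u|² = |v|² = L it is
-- determined by p = x·u and q = x·v through L·x = p·u + q·v.  So the lattice points of tS correspond
-- to the pairs (p, q) ∈ [0, tL]² with L ∣ p·u + q·v.  With d = gcd u, d' = gcd v and D = gcd (u × v),
-- one has d ∣ D, and D ∣ L because D divides both L·d and L·d' (these are the gcds of v × (u × v) and
-- u × (u × v)) while gcd(d, d') = 1.  Put e = D/d.  The admissible pairs are periodic in p with period
-- L/d, have exactly one p per period on the rows q ∈ (L/e)ℕ and none on the other rows, and the pairs
-- with p = 0 are those with L/d' ∣ q.  Counting row by row gives td(te + 1) + (td' + 1), which is
-- Dt² + (d + d')t + 1.

module Submission where

open import Defs
open import Data.Product using (∃; ∃₂; _×_; _,_; proj₁; proj₂)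
open import Data.Sum using (inj₁; inj₂)
open import Function.Bundles using (_⇔_; mk⇔)
open import Relation.Binary.PropositionalEquality
open import Relation.Nullary using (Dec)
import Data.Integer as ℤ

cong³ : ∀ {A : Set} {x y z x' y' z' : A} → x ≡ x' → y ≡ y' → z ≡ z' → (x , y , z) ≡ (x' , y' , z')
cong³ refl refl refl = refl

module IntegerVectors where
  open import Data.Integer as ℤ using (ℤ; +_; -1ℤ; _+_; _*_; _-_; -_)
  import Data.Integer.Properties as ℤ
  open import Data.Integer.Tactic.RingSolver using (solve-∀)
  open ≡-Reasoning

  infixr 25 _*³_
  infix 20 _-³_

  _*³_ : ℤ → ℤ³ → ℤ³
  k *³ (x , y , z) = k * x , k * y , k * z

  _-³_ : ℤ³ → ℤ³ → ℤ³
  (x , y , z) -³ (x' , y' , z') = x - x' , y - y' , z - z'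

  -- The cross product, with every coordinate in the same cyclic form (so a coordinatewise identity
  -- often needs one ring-solver lemma, instantiated three times); Defs.cross differs in the sign
  -- of the second coordinate.
  _⨯_ : ℤ³ → ℤ³ → ℤ³
  (a , b , c) ⨯ (a' , b' , c') = b * c' - b' * c , c * a' - c' * a , a * b' - a' * b

  dot-comm : ∀ x y → dot x y ≡ dot y x
  dot-comm (a , b , c) (a' , b' , c') = solve-∀′ a b c a' b' c'
    where solve-∀′ : ∀ a b c a' b' c' → a * a' + b * b' + c * c' ≡ a' * a + b' * b + c' * c
          solve-∀′ = solve-∀

  dot-*³ˡ : ∀ k x y → dot (k *³ x) y ≡ k * dot x y
  dot-*³ˡ k (a , b , c) (a' , b' , c') = solve-∀′ k a b c a' b' c'
    where solve-∀′ : ∀ k a b c a' b' c' → k * a * a' + k * b * b' + k * c * c' ≡ k * (a * a' + b * b' + c * c')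
          solve-∀′ = solve-∀

  dot-+³ˡ : ∀ P Q x y z → dot (P *³ x +³ Q *³ y) z ≡ P * dot x z + Q * dot y z
  dot-+³ˡ P Q (a , b , c) (a' , b' , c') (a″ , b″ , c″) = solve-∀′ P Q a b c a' b' c' a″ b″ c″
    where solve-∀′ : ∀ P Q a b c a' b' c' a″ b″ c″ →
                     (P * a + Q * a') * a″ + (P * b + Q * b') * b″ + (P * c + Q * c') * c″ ≡
                     P * (a * a″ + b * b″ + c * c″) + Q * (a' * a″ + b' * b″ + c' * c″)
          solve-∀′ = solve-∀

  dot--³ˡ : ∀ P Q x y z → dot (P *³ x -³ Q *³ y) z ≡ P * dot x z - Q * dot y z
  dot--³ˡ P Q (a , b , c) (a' , b' , c') (a″ , b″ , c″) = solve-∀′ P Q a b c a' b' c' a″ b″ c″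
    where solve-∀′ : ∀ P Q a b c a' b' c' a″ b″ c″ →
                     (P * a - Q * a') * a″ + (P * b - Q * b') * b″ + (P * c - Q * c') * c″ ≡
                     P * (a * a″ + b * b″ + c * c″) - Q * (a' * a″ + b' * b″ + c' * c″)
          solve-∀′ = solve-∀

  dot-⨯ˡ : ∀ x y → dot x (x ⨯ y) ≡ + 0
  dot-⨯ˡ (a , b , c) (a' , b' , c') = solve-∀′ a b c a' b' c'
    where solve-∀′ : ∀ a b c a' b' c' → a * (b * c' - b' * c) + b * (c * a' - c' * a) + c * (a * b' - a' * b) ≡ + 0
          solve-∀′ = solve-∀

  dot-⨯ʳ : ∀ x y → dot y (x ⨯ y) ≡ + 0
  dot-⨯ʳ (a , b , c) (a' , b' , c') = solve-∀′ a b c a' b' c'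
    where solve-∀′ : ∀ a b c a' b' c' → a' * (b * c' - b' * c) + b' * (c * a' - c' * a) + c' * (a * b' - a' * b) ≡ + 0
          solve-∀′ = solve-∀

  *³-+-split : ∀ P K Q x y → (P + K) *³ x +³ Q *³ y ≡ K *³ x +³ (P *³ x +³ Q *³ y)
  *³-+-split P K Q (a , b , c) (a' , b' , c') = cong³ (coord P K Q a a') (coord P K Q b b') (coord P K Q c c')
    where coord : ∀ P K Q a a' → (P + K) * a + Q * a' ≡ K * a + (P * a + Q * a')
          coord = solve-∀

  *³-+³-difference : ∀ P P' Q x y → (P *³ x +³ Q *³ y) -³ (P' *³ x +³ Q *³ y) ≡ (P - P') *³ x
  *³-+³-difference P P' Q (a , b , c) (a' , b' , c') =
    cong³ (coord P P' Q a a') (coord P P' Q b b') (coord P P' Q c c')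
    where coord : ∀ P P' Q a a' → (P * a + Q * a') - (P' * a + Q * a') ≡ (P - P') * a
          coord = solve-∀

  *³-+³-zeroˡ : ∀ Q x y → (+ 0) *³ x +³ Q *³ y ≡ Q *³ y
  *³-+³-zeroˡ Q (a , b , c) (a' , b' , c') = cong³ (coord Q a a') (coord Q b b') (coord Q c c')
    where coord : ∀ Q a a' → + 0 * a + Q * a' ≡ Q * a'
          coord = solve-∀

  *³--³-zeroʳ : ∀ k x y → k *³ x -³ (+ 0) *³ y ≡ k *³ x
  *³--³-zeroʳ k (a , b , c) (a' , b' , c') = cong³ (coord k a a') (coord k b b') (coord k c c')
    where coord : ∀ k a a' → k * a - + 0 * a' ≡ k * a
          coord = solve-∀

  *³--³-zeroˡ : ∀ k x y → (+ 0) *³ x -³ k *³ y ≡ (- k) *³ y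
  *³--³-zeroˡ k (a , b , c) (a' , b' , c') = cong³ (coord k a a') (coord k b b') (coord k c c')
    where coord : ∀ k a a' → + 0 * a - k * a' ≡ - k * a'
          coord = solve-∀

  ⨯-anticomm : ∀ x y → y ⨯ x ≡ -1ℤ *³ (x ⨯ y)
  ⨯-anticomm (a , b , c) (a' , b' , c') = cong³ (coord b c b' c') (coord c a c' a') (coord a b a' b')
    where coord : ∀ p q p' q' → p' * q - p * q' ≡ -1ℤ * (p * q' - p' * q)
          coord = solve-∀

  ⨯-*³ʳ : ∀ k x y → x ⨯ (k *³ y) ≡ k *³ (x ⨯ y)
  ⨯-*³ʳ k (a , b , c) (a' , b' , c') = cong³ (coord k b c b' c') (coord k c a c' a') (coord k a b a' b')
    where coord : ∀ k p q p' q' → p * (k * q') - k * p' * q ≡ k * (p * q' - p' * q)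
          coord = solve-∀

  ⨯-parallelˡ : ∀ P Q k x y → (P *³ k *³ x +³ Q *³ y) ⨯ x ≡ Q *³ (y ⨯ x)
  ⨯-parallelˡ P Q k (a , b , c) (a' , b' , c') =
    cong³ (coord P Q k b c b' c') (coord P Q k c a c' a') (coord P Q k a b a' b')
    where coord : ∀ P Q k p q p' q' → (P * (k * p) + Q * p') * q - p * (P * (k * q) + Q * q') ≡ Q * (p' * q - p * q')
          coord = solve-∀

  ⨯-⨯ʳ : ∀ x y z → x ⨯ (y ⨯ z) ≡ dot x z *³ y -³ dot x y *³ z
  ⨯-⨯ʳ (a , b , c) (a' , b' , c') (a″ , b″ , c″) = cong³
    (coord1 a b c a' b' c' a″ b″ c″) (coord2 a b c a' b' c' a″ b″ c″) (coord3 a b c a' b' c' a″ b″ c″)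
    where
    coord1 : ∀ a b c a' b' c' a″ b″ c″ →
      b * (a' * b″ - a″ * b') - (c' * a″ - c″ * a') * c ≡ (a * a″ + b * b″ + c * c″) * a' - (a * a' + b * b' + c * c') * a″
    coord2 : ∀ a b c a' b' c' a″ b″ c″ →
      c * (b' * c″ - b″ * c') - (a' * b″ - a″ * b') * a ≡ (a * a″ + b * b″ + c * c″) * b' - (a * a' + b * b' + c * c') * b″
    coord3 : ∀ a b c a' b' c' a″ b″ c″ →
      a * (c' * a″ - c″ * a') - (b' * c″ - b″ * c') * b ≡ (a * a″ + b * b″ + c * c″) * c' - (a * a' + b * b' + c * c') * c″
    coord1 = solve-∀
    coord2 = solve-∀
    coord3 = solve-∀

  cross-bézout : ∀ e y₀ x v w₀ → dot y₀ x ≡ + 1 → v ⨯ x ≡ e *³ w₀ → ∀ z →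
                 e * dot (y₀ ⨯ w₀) z ≡ + 1 * dot v z - dot y₀ v * dot x z
  cross-bézout e y₀ x v w₀ y₀·x≡1 v⨯x≡e*w₀ z = begin
    e * dot (y₀ ⨯ w₀) z                             ≡⟨ sym (dot-*³ˡ e (y₀ ⨯ w₀) z) ⟩
    dot (e *³ (y₀ ⨯ w₀)) z                          ≡⟨ cong (λ x → dot x z) (sym (⨯-*³ʳ e y₀ w₀)) ⟩
    dot (y₀ ⨯ (e *³ w₀)) z                          ≡⟨ cong (λ w → dot (y₀ ⨯ w) z) (sym v⨯x≡e*w₀) ⟩
    dot (y₀ ⨯ (v ⨯ x)) z                            ≡⟨ cong (λ x → dot x z) (⨯-⨯ʳ y₀ v x) ⟩
    dot (dot y₀ x *³ v -³ dot y₀ v *³ x) z          ≡⟨ dot--³ˡ (dot y₀ x) (dot y₀ v) v x z ⟩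
    dot y₀ x * dot v z - dot y₀ v * dot x z         ≡⟨ cong (λ α → α * dot v z - dot y₀ v * dot x z) y₀·x≡1 ⟩
    + 1 * dot v z - dot y₀ v * dot x z              ∎

  -- The expansion of x in the frame u, v, u × v, scaled by |u × v|² = |u|²|v|² − (u·v)².
  gram : ∀ u v x →
    (dot u u * dot v v - dot u v * dot u v) *³ x ≡
    ((dot v v * dot x u - dot u v * dot x v) *³ u +³ (dot u u * dot x v - dot u v * dot x u) *³ v) +³ dot x (u ⨯ v) *³ (u ⨯ v)
  gram (a , b , c) (a' , b' , c') (x₁ , x₂ , x₃) = cong³
    (coord1 a b c a' b' c' x₁ x₂ x₃) (coord2 a b c a' b' c' x₁ x₂ x₃) (coord3 a b c a' b' c' x₁ x₂ x₃)
    where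
    coord1 : ∀ a b c a' b' c' x₁ x₂ x₃ →
      ((a * a + b * b + c * c) * (a' * a' + b' * b' + c' * c') - (a * a' + b * b' + c * c') * (a * a' + b * b' + c * c')) * x₁ ≡
      ((a' * a' + b' * b' + c' * c') * (x₁ * a + x₂ * b + x₃ * c) - (a * a' + b * b' + c * c') * (x₁ * a' + x₂ * b' + x₃ * c')) * a + ((a * a + b * b + c * c) * (x₁ * a' + x₂ * b' + x₃ * c') - (a * a' + b * b' + c * c') * (x₁ * a + x₂ * b + x₃ * c)) * a' +
      (x₁ * (b * c' - b' * c) + x₂ * (c * a' - c' * a) + x₃ * (a * b' - a' * b)) * (b * c' - b' * c)
    coord2 : ∀ a b c a' b' c' x₁ x₂ x₃ →
      ((a * a + b * b + c * c) * (a' * a' + b' * b' + c' * c') - (a * a' + b * b' + c * c') * (a * a' + b * b' + c * c')) * x₂ ≡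
      ((a' * a' + b' * b' + c' * c') * (x₁ * a + x₂ * b + x₃ * c) - (a * a' + b * b' + c * c') * (x₁ * a' + x₂ * b' + x₃ * c')) * b + ((a * a + b * b + c * c) * (x₁ * a' + x₂ * b' + x₃ * c') - (a * a' + b * b' + c * c') * (x₁ * a + x₂ * b + x₃ * c)) * b' +
      (x₁ * (b * c' - b' * c) + x₂ * (c * a' - c' * a) + x₃ * (a * b' - a' * b)) * (c * a' - c' * a)
    coord3 : ∀ a b c a' b' c' x₁ x₂ x₃ →
      ((a * a + b * b + c * c) * (a' * a' + b' * b' + c' * c') - (a * a' + b * b' + c * c') * (a * a' + b * b' + c * c')) * x₃ ≡
      ((a' * a' + b' * b' + c' * c') * (x₁ * a + x₂ * b + x₃ * c) - (a * a' + b * b' + c * c') * (x₁ * a' + x₂ * b' + x₃ * c')) * c + ((a * a + b * b + c * c) * (x₁ * a' + x₂ * b' + x₃ * c') - (a * a' + b * b' + c * c') * (x₁ * a + x₂ * b + x₃ * c)) * c' +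
      (x₁ * (b * c' - b' * c) + x₂ * (c * a' - c' * a) + x₃ * (a * b' - a' * b)) * (a * b' - a' * b)
    coord1 = solve-∀
    coord2 = solve-∀
    coord3 = solve-∀

  plane-expansion : ∀ u v x ℓ .{{_ : ℤ.NonZero ℓ}} → dot u u ≡ ℓ → dot v v ≡ ℓ → dot u v ≡ + 0 →
                    dot x (u ⨯ v) ≡ + 0 → ℓ *³ x ≡ dot x u *³ u +³ dot x v *³ v
  plane-expansion u v x ℓ uu vv uv xn = cancel x u v (u ⨯ v) uu vv uv xn (gram u v x)
    where
    coord : ∀ {X Y x a a' n} → (ℓ * ℓ - + 0 * + 0) * x ≡ (ℓ * X - + 0 * Y) * a + (ℓ * Y - + 0 * X) * a' + + 0 * n →
            ℓ * x ≡ X * a + Y * a'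
    coord {X} {Y} {x} {a} {a'} {n} e = ℤ.*-cancelˡ-≡ ℓ _ _ (begin
      ℓ * (ℓ * x)                                                ≡⟨ square ℓ x ⟩
      (ℓ * ℓ - + 0 * + 0) * x                                    ≡⟨ e ⟩
      (ℓ * X - + 0 * Y) * a + (ℓ * Y - + 0 * X) * a' + + 0 * n   ≡⟨ factor ℓ X Y a a' n ⟩
      ℓ * (X * a + Y * a')                                       ∎)
      where
      square : ∀ ℓ x → ℓ * (ℓ * x) ≡ (ℓ * ℓ - + 0 * + 0) * x
      square = solve-∀
      factor : ∀ ℓ X Y a a' n → (ℓ * X - + 0 * Y) * a + (ℓ * Y - + 0 * X) * a' + + 0 * n ≡ ℓ * (X * a + Y * a')
      factor = solve-∀
    cancel : ∀ {UU VV UV XU XV XN} x u v n → UU ≡ ℓ → VV ≡ ℓ → UV ≡ + 0 → XN ≡ + 0 →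
             (UU * VV - UV * UV) *³ x ≡ ((VV * XU - UV * XV) *³ u +³ (UU * XV - UV * XU) *³ v) +³ XN *³ n →
             ℓ *³ x ≡ XU *³ u +³ XV *³ v
    cancel {XU = X} {XV = Y} (_ , _ , _) (_ , _ , _) (_ , _ , _) (n₁ , n₂ , n₃) refl refl refl refl e = cong³
      (coord {X} {Y} {n = n₁} (cong proj₁ e))
      (coord {X} {Y} {n = n₂} (cong (λ w → proj₁ (proj₂ w)) e))
      (coord {X} {Y} {n = n₃} (cong (λ w → proj₂ (proj₂ w)) e))

module VectorDivisibility where
  open import Data.Nat as ℕ using (ℕ; NonZero)
  import Data.Nat.Properties as ℕ
  import Data.Nat.Divisibility as ℕ
  import Data.Nat.DivMod as ℕ
  open import Data.Nat.GCD using (gcd; gcd-GCD; gcd[m,n]∣m; gcd[m,n]∣n; gcd-greatest; c*gcd[m,n]≡gcd[cm,cn]; module Bézout)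
  open import Data.Integer as ℤ using (ℤ; +_; -[1+_]; ∣_∣; _/ℕ_; _%ℕ_; _+_; _*_; _-_; -_)
  import Data.Integer.Properties as ℤ
  open import Data.Integer.Divisibility.Signed using (_∣_; _∣?_; divides; ∣-refl; ∣m+n∣m⇒∣n; ∣ᵤ⇒∣; ∣⇒∣ᵤ; ∣m∣n⇒∣m+n; ∣m∣n⇒∣m-n; ∣n⇒∣m*n; ∣m⇒∣m*n)
  open import Data.Integer.DivMod using (a≡a%ℕn+[a/ℕn]*n)
  open import Data.Integer.Tactic.RingSolver using (solve-∀)
  open import Relation.Nullary.Decidable using (_×-dec_)
  open IntegerVectors
  open ≡-Reasoning

  infix 4 _∣³_ _∣³?_

  _∣³_ : ℤ → ℤ³ → Set
  k ∣³ (x , y , z) = (k ∣ x) × (k ∣ y) × (k ∣ z)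

  _∣³?_ : ∀ k x → Dec (k ∣³ x)
  k ∣³? (a , b , c) = (k ∣? a) ×-dec (k ∣? b) ×-dec (k ∣? c)

  ∣³-+ : ∀ {k} x y → k ∣³ x → k ∣³ y → k ∣³ x +³ y
  ∣³-+ _ _ (p₁ , p₂ , p₃) (q₁ , q₂ , q₃) = ∣m∣n⇒∣m+n p₁ q₁ , ∣m∣n⇒∣m+n p₂ q₂ , ∣m∣n⇒∣m+n p₃ q₃

  ∣³--³ : ∀ {k} x y → k ∣³ x → k ∣³ y → k ∣³ x -³ y
  ∣³--³ _ _ (p₁ , p₂ , p₃) (q₁ , q₂ , q₃) = ∣m∣n⇒∣m-n p₁ q₁ , ∣m∣n⇒∣m-n p₂ q₂ , ∣m∣n⇒∣m-n p₃ q₃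

  ∣³-refl-*³ : ∀ k x → k ∣³ k *³ x
  ∣³-refl-*³ k (a , b , c) = ∣m⇒∣m*n a ∣-refl , ∣m⇒∣m*n b ∣-refl , ∣m⇒∣m*n c ∣-refl

  ∣³-+-cancelˡ : ∀ {k} x y → k ∣³ x +³ y → k ∣³ x → k ∣³ y
  ∣³-+-cancelˡ (_ , _ , _) (_ , _ , _) (p₁ , p₂ , p₃) (q₁ , q₂ , q₃) = ∣m+n∣m⇒∣n p₁ q₁ , ∣m+n∣m⇒∣n p₂ q₂ , ∣m+n∣m⇒∣n p₃ q₃

  ∣³-⨯ˡ : ∀ {k} x y → k ∣³ x → k ∣³ x ⨯ y
  ∣³-⨯ˡ (a , b , c) (a' , b' , c') (p₁ , p₂ , p₃) =
    ∣m∣n⇒∣m-n (∣m⇒∣m*n c' p₂) (∣n⇒∣m*n b' p₃) ,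
    ∣m∣n⇒∣m-n (∣m⇒∣m*n a' p₃) (∣n⇒∣m*n c' p₁) ,
    ∣m∣n⇒∣m-n (∣m⇒∣m*n b' p₁) (∣n⇒∣m*n a' p₂)

  ∣³-⨯ʳ : ∀ {k} x y → k ∣³ y → k ∣³ x ⨯ y
  ∣³-⨯ʳ (a , b , c) (a' , b' , c') (p₁ , p₂ , p₃) =
    ∣m∣n⇒∣m-n (∣n⇒∣m*n b p₃) (∣m⇒∣m*n c p₂) ,
    ∣m∣n⇒∣m-n (∣n⇒∣m*n c p₁) (∣m⇒∣m*n a p₃) ,
    ∣m∣n⇒∣m-n (∣n⇒∣m*n a p₂) (∣m⇒∣m*n b p₁)

  ∣³⇒∣dot : ∀ {k} x y → k ∣³ x → k ∣ dot x y
  ∣³⇒∣dot (a , b , c) (a' , b' , c') (p₁ , p₂ , p₃) =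
    ∣m∣n⇒∣m+n (∣m∣n⇒∣m+n (∣m⇒∣m*n a' p₁) (∣m⇒∣m*n b' p₂)) (∣m⇒∣m*n c' p₃)

  ∣³-quotient : ∀ {k} x → k ∣³ x → ∃ λ y → x ≡ k *³ y
  ∣³-quotient {k} (a , b , c) (divides qa refl , divides qb refl , divides qc refl) =
    (qa , qb , qc) , cong³ (ℤ.*-comm qa k) (ℤ.*-comm qb k) (ℤ.*-comm qc k)

  _/³_ : ℤ³ → (L : ℕ) → .{{NonZero L}} → ℤ³
  (a , b , c) /³ L = a /ℕ L , b /ℕ L , c /ℕ L

  /ℕ-exact : ∀ {i} L .{{_ : NonZero L}} → + L ∣ i → (i /ℕ L) * + L ≡ i
  /ℕ-exact {i} L L∣i = sym (begin
    i                             ≡⟨ a≡a%ℕn+[a/ℕn]*n i L ⟩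
    + (i %ℕ L) + (i /ℕ L) * + L   ≡⟨ cong (λ r → + r + (i /ℕ L) * + L) (remainder i (∣⇒∣ᵤ L∣i)) ⟩
    + 0 + (i /ℕ L) * + L          ≡⟨ ℤ.+-identityˡ _ ⟩
    (i /ℕ L) * + L                ∎)
    where
    remainder : ∀ i → L ℕ.∣ ∣ i ∣ → i %ℕ L ≡ 0
    remainder (+ n)      L∣n = ℕ.n∣m⇒m%n≡0 n L L∣n
    remainder -[1+ n ] L∣n rewrite ℕ.n∣m⇒m%n≡0 (ℕ.suc n) L L∣n = refl

  /³-exact : ∀ L .{{_ : NonZero L}} x → + L ∣³ x → (+ L) *³ (x /³ L) ≡ x
  /³-exact L (a , b , c) (L∣a , L∣b , L∣c) = cong³ (exact L∣a) (exact L∣b) (exact L∣c)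
    where exact : ∀ {i} → + L ∣ i → + L * (i /ℕ L) ≡ i
          exact L∣i = trans (ℤ.*-comm (+ L) _) (/ℕ-exact L L∣i)

  *³-/³ : ∀ L .{{_ : NonZero L}} x → ((+ L) *³ x) /³ L ≡ x
  *³-/³ L (a , b , c) = cong³ (cancel a) (cancel b) (cancel c)
    where cancel : ∀ i → (+ L * i) /ℕ L ≡ i
          cancel i = ℤ.*-cancelʳ-≡ _ i (+ L) (trans (/ℕ-exact L (∣m⇒∣m*n i ∣-refl)) (ℤ.*-comm (+ L) i))

  private
    ≡-from-∣-difference-≤ : ∀ {m p p'} → p ℕ.≤ p' → p' ℕ.< m → m ℕ.∣ ∣ + p - + p' ∣ → p ≡ p'
    ≡-from-∣-difference-≤ {m} {p} {p'} p≤p' p'<m m∣p-p' =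
      ℕ.≤-antisym p≤p' (ℕ.m∸n≡0⇒m≤n (small-multiple (subst (m ℕ.∣_) distance m∣p-p') (ℕ.≤-<-trans (ℕ.m∸n≤m p' p) p'<m)))
      where
      distance : ∣ + p - + p' ∣ ≡ p' ℕ.∸ p
      distance = trans (cong ∣_∣ (ℤ.m-n≡m⊖n p p')) (ℤ.∣⊖∣-≤ p≤p')
      small-multiple : ∀ {k} → m ℕ.∣ k → k ℕ.< m → k ≡ 0
      small-multiple {k} m∣k k<m = trans (sym (ℕ.m<n⇒m%n≡m k<m)) (ℕ.n∣m⇒m%n≡0 k m m∣k)
        where instance _ = ℕ.>-nonZero (ℕ.≤-<-trans ℕ.z≤n k<m)

  ≡-from-∣-difference : ∀ {m p p'} → p ℕ.< m → p' ℕ.< m → + m ∣ + p - + p' → p ≡ p'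
  ≡-from-∣-difference {m} {p} {p'} p<m p'<m m∣p-p' with ℕ.≤-total p p'
  ... | inj₁ p≤p' = ≡-from-∣-difference-≤ p≤p' p'<m (∣⇒∣ᵤ m∣p-p')
  ... | inj₂ p'≤p = sym (≡-from-∣-difference-≤ p'≤p p<m (subst (m ℕ.∣_) (ℤ.∣i-j∣≡∣j-i∣ (+ p) (+ p')) (∣⇒∣ᵤ m∣p-p')))

  gcd³∣³ : ∀ x → + gcd³ x ∣³ x
  gcd³∣³ (a , b , c) =
    ∣ᵤ⇒∣ (gcd[m,n]∣m _ _) ,
    ∣ᵤ⇒∣ (ℕ.∣-trans (gcd[m,n]∣n (∣ a ∣) _) (gcd[m,n]∣m (∣ b ∣) (∣ c ∣))) ,
    ∣ᵤ⇒∣ (ℕ.∣-trans (gcd[m,n]∣n (∣ a ∣) _) (gcd[m,n]∣n (∣ b ∣) (∣ c ∣)))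

  gcd³-greatest : ∀ {k} x → + k ∣³ x → k ℕ.∣ gcd³ x
  gcd³-greatest (a , b , c) (p₁ , p₂ , p₃) = gcd-greatest (∣⇒∣ᵤ p₁) (gcd-greatest (∣⇒∣ᵤ p₂) (∣⇒∣ᵤ p₃))

  gcd³-*³ : ∀ k x → gcd³ (k *³ x) ≡ ∣ k ∣ ℕ.* gcd³ x
  gcd³-*³ k (a , b , c) rewrite ℤ.abs-* k a | ℤ.abs-* k b | ℤ.abs-* k c = begin
    gcd (∣ k ∣ ℕ.* ∣ a ∣) (gcd (∣ k ∣ ℕ.* ∣ b ∣) (∣ k ∣ ℕ.* ∣ c ∣))
      ≡⟨ cong (gcd (∣ k ∣ ℕ.* ∣ a ∣)) (sym (c*gcd[m,n]≡gcd[cm,cn] (∣ k ∣) (∣ b ∣) (∣ c ∣))) ⟩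
    gcd (∣ k ∣ ℕ.* ∣ a ∣) (∣ k ∣ ℕ.* gcd ∣ b ∣ ∣ c ∣)
      ≡⟨ sym (c*gcd[m,n]≡gcd[cm,cn] (∣ k ∣) (∣ a ∣) _) ⟩
    ∣ k ∣ ℕ.* gcd³ (a , b , c) ∎

  gcd³-cross : ∀ x y → gcd³ (cross x y) ≡ gcd³ (x ⨯ y)
  gcd³-cross (a , b , c) (a' , b' , c') = cong (λ k → gcd (∣ b * c' - b' * c ∣) (gcd k (∣ a * b' - a' * b ∣)))
    (trans (sym (ℤ.∣-i∣≡∣i∣ (a * c' - a' * c))) (cong ∣_∣ (negate a c a' c')))
    where negate : ∀ a c a' c' → - (a * c' - a' * c) ≡ c * a' - c' * a
          negate = solve-∀

  ∣³-*³⇔ : ∀ {L r} p x → .{{NonZero (gcd³ x)}} → L ≡ gcd³ x ℕ.* r → (+ L ∣³ p *³ x) ⇔ (+ r ∣ p)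
  ∣³-*³⇔ {L} {r} p x refl = mk⇔ to from
    where
    to : + L ∣³ p *³ x → + r ∣ p
    to L∣px = ∣ᵤ⇒∣ (ℕ.*-cancelˡ-∣ (gcd³ x) (subst (L ℕ.∣_) (trans (gcd³-*³ p x) (ℕ.*-comm ∣ p ∣ _)) (gcd³-greatest _ L∣px)))
    from : + r ∣ p → + L ∣³ p *³ x
    from r∣p with gcd³∣³ x
    ... | g∣a , g∣b , g∣c = scale g∣a , scale g∣b , scale g∣c
      where
      scale : ∀ {a} → + gcd³ x ∣ a → + L ∣ p * a
      scale g∣a = ∣ᵤ⇒∣ (subst (L ℕ.∣_) (trans (ℕ.*-comm _ ∣ p ∣) (sym (ℤ.abs-* p _))) (ℕ.*-pres-∣ (∣⇒∣ᵤ g∣a) (∣⇒∣ᵤ r∣p)))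

  private
    pos-+* : ∀ {g x y m n} → g ℕ.+ y ℕ.* n ≡ x ℕ.* m → + g + + y * + n ≡ + x * + m
    pos-+* {g} {x} {y} {m} {n} e = trans (cong (λ k → + g + k) (sym (ℤ.pos-* y n)))
      (trans (sym (ℤ.pos-+ g _)) (trans (cong +_ e) (ℤ.pos-* x m)))

  bézout : ∀ m n → ∃₂ λ α β → α * + m + β * + n ≡ + gcd m n
  bézout m n with Bézout.identity (gcd-GCD m n)
  ... | Bézout.+- x y eq = + x , - + y ,
    trans (cong (λ k → + x * + m + k) (sym (ℤ.neg-distribˡ-* (+ y) (+ n)))) (x-y≡g {y = + y * + n} (pos-+* {gcd m n} {x} {y} {m} {n} eq))
    where
    x-y≡g : ∀ {g x y} → g + y ≡ x → x - y ≡ g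
    x-y≡g {g} {y = y} refl = solve-∀′ g y
      where solve-∀′ : ∀ g y → g + y - y ≡ g
            solve-∀′ = solve-∀
  ... | Bézout.-+ x y eq = - + x , + y ,
    trans (cong (_+ + y * + n) (sym (ℤ.neg-distribˡ-* (+ x) (+ m)))) (-x+y≡g {x = + x * + m} (pos-+* {gcd m n} {y} {x} {n} {m} eq))
    where
    -x+y≡g : ∀ {g x y} → g + x ≡ y → - x + y ≡ g
    -x+y≡g {g} {x} refl = solve-∀′ g x
      where solve-∀′ : ∀ g x → - x + (g + x) ≡ g
            solve-∀′ = solve-∀

  sign-unit : ∀ i → ∃ λ s → s * i ≡ + (∣ i ∣)
  sign-unit i with ℤ.+∣i∣≡i⊎+∣i∣≡-i i
  ... | inj₁ e = + 1 , trans (ℤ.*-identityˡ i) (sym e)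
  ... | inj₂ e = - + 1 , trans (ℤ.-1*i≡-i i) (sym e)

  bézoutℤ : ∀ i j → ∃₂ λ α β → α * i + β * j ≡ + gcd (∣ i ∣) (∣ j ∣)
  bézoutℤ i j with sign-unit i | sign-unit j | bézout (∣ i ∣) (∣ j ∣)
  ... | s , si | t , tj | α , β , e = α * s , β * t , (begin
    α * s * i + β * t * j     ≡⟨ cong₂ _+_ (ℤ.*-assoc α s i) (ℤ.*-assoc β t j) ⟩
    α * (s * i) + β * (t * j) ≡⟨ cong₂ (λ x y → α * x + β * y) si tj ⟩
    α * + (∣ i ∣) + β * + (∣ j ∣) ≡⟨ e ⟩
    + gcd (∣ i ∣) (∣ j ∣)         ∎)

  bézout³ : ∀ x → gcd³ x ≡ 1 → ∃ λ y → dot y x ≡ + 1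
  bézout³ (a , b , c) g≡1 with bézoutℤ b c
  ... | α₁ , β₁ , e₁ with bézoutℤ a (+ gcd (∣ b ∣) (∣ c ∣))
  ...   | α₂ , β₂ , e₂ = (α₂ , β₂ * α₁ , β₂ * β₁) , (begin
    α₂ * a + β₂ * α₁ * b + β₂ * β₁ * c ≡⟨ distrib α₂ β₂ α₁ β₁ a b c ⟩
    α₂ * a + β₂ * (α₁ * b + β₁ * c)    ≡⟨ cong (λ k → α₂ * a + β₂ * k) e₁ ⟩
    α₂ * a + β₂ * + gcd (∣ b ∣) (∣ c ∣)    ≡⟨ e₂ ⟩
    + gcd³ (a , b , c)                 ≡⟨ cong +_ g≡1 ⟩
    + 1                                ∎)
    where
    distrib : ∀ α₂ β₂ α₁ β₁ a b c →
      α₂ * a + β₂ * α₁ * b + β₂ * β₁ * c ≡ α₂ * a + β₂ * (α₁ * b + β₁ * c)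
    distrib = solve-∀

module Counting where
  open import Data.Nat
  open import Data.Nat.Properties
  open import Data.Nat.Divisibility using (_∣_; _∣?_; divides; ∣-refl; ∣m∣n⇒∣m+n; ∣m+n∣m⇒∣n; n∣m*n; ∣⇒≤)
  open import Data.Nat.Tactic.RingSolver using (solve-∀)
  open import Data.Empty using (⊥-elim)
  open import Relation.Nullary using (Dec; yes; no; ¬_)
  open import Relation.Unary using (Decidable)
  open import Function.Bundles using (module Equivalence)
  open Equivalence using (to; from)
  open ≡-Reasoning

  indicator : ∀ {A : Set} → Dec A → ℕ
  indicator (yes _) = 1
  indicator (no _)  = 0

  indicator-cong : ∀ {A B : Set} (A? : Dec A) (B? : Dec B) → A ⇔ B → indicator A? ≡ indicator B?
  indicator-cong (yes _) (yes _) _   = refl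
  indicator-cong (yes a) (no ¬b) A⇔B = ⊥-elim (¬b (to A⇔B a))
  indicator-cong (no ¬a) (yes b) A⇔B = ⊥-elim (¬a (from A⇔B b))
  indicator-cong (no _)  (no _)  _   = refl

  indicator-yes : ∀ {A : Set} (A? : Dec A) → A → indicator A? ≡ 1
  indicator-yes (yes _) _ = refl
  indicator-yes (no ¬a) a = ⊥-elim (¬a a)

  sum< : (ℕ → ℕ) → ℕ → ℕ
  sum< f zero    = 0
  sum< f (suc n) = sum< f n + f n

  count< : {P : ℕ → Set} → Decidable P → ℕ → ℕ
  count< P? = sum< (λ k → indicator (P? k))

  sum<-cong : ∀ f g n → (∀ k → k < n → f k ≡ g k) → sum< f n ≡ sum< g n
  sum<-cong f g zero    _  = refl
  sum<-cong f g (suc n) eq = cong₂ _+_ (sum<-cong f g n (λ k k<n → eq k (m<n⇒m<1+n k<n))) (eq n ≤-refl)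

  sum<-+ : ∀ f g n → sum< (λ k → f k + g k) n ≡ sum< f n + sum< g n
  sum<-+ f g zero    = refl
  sum<-+ f g (suc n) rewrite sum<-+ f g n = interchange (sum< f n) (sum< g n) (f n) (g n)
    where interchange : ∀ a b c d → a + b + (c + d) ≡ a + c + (b + d)
          interchange = solve-∀

  sum<-* : ∀ c f n → sum< (λ k → c * f k) n ≡ c * sum< f n
  sum<-* c f zero    = sym (*-zeroʳ c)
  sum<-* c f (suc n) rewrite sum<-* c f n = sym (*-distribˡ-+ c (sum< f n) (f n))

  sum<-+-shift : ∀ f j n → sum< f (j + n) ≡ sum< f j + sum< (λ k → f (j + k)) n
  sum<-+-shift f j zero    = trans (cong (sum< f) (+-identityʳ j)) (sym (+-identityʳ _))
  sum<-+-shift f j (suc n) = begin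
    sum< f (j + suc n)                                    ≡⟨ cong (sum< f) (+-suc j n) ⟩
    sum< f (j + n) + f (j + n)                            ≡⟨ cong (_+ f (j + n)) (sum<-+-shift f j n) ⟩
    sum< f j + sum< (λ k → f (j + k)) n + f (j + n)       ≡⟨ +-assoc (sum< f j) _ _ ⟩
    sum< f j + (sum< (λ k → f (j + k)) n + f (j + n))     ∎

  sum<-periodic : ∀ f r → (∀ k → f (r + k) ≡ f k) → ∀ s → sum< f (s * r) ≡ s * sum< f r
  sum<-periodic f r per zero    = refl
  sum<-periodic f r per (suc s) = begin
    sum< f (r + s * r)                          ≡⟨ sum<-+-shift f r (s * r) ⟩
    sum< f r + sum< (λ k → f (r + k)) (s * r)  ≡⟨ cong (sum< f r +_) (sum<-cong _ f (s * r) (λ k _ → per k)) ⟩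
    sum< f r + sum< f (s * r)                   ≡⟨ cong (sum< f r +_) (sum<-periodic f r per s) ⟩
    sum< f r + s * sum< f r                     ∎

  count<-none : ∀ {P : ℕ → Set} (P? : Decidable P) n → (∀ k → k < n → ¬ P k) → count< P? n ≡ 0
  count<-none P? zero    _  = refl
  count<-none P? (suc n) ¬P with P? n
  ... | yes p = ⊥-elim (¬P n ≤-refl p)
  ... | no _  = trans (+-identityʳ _) (count<-none P? n (λ k k<n → ¬P k (m<n⇒m<1+n k<n)))

  count<-unique : ∀ {P : ℕ → Set} (P? : Decidable P) n r → r < n → P r →
                  (∀ k → k < n → P k → k ≡ r) → count< P? n ≡ 1
  count<-unique P? (suc n) r r<n Pr unique with r ≟ n | P? n
  ... | yes refl | yes _  = cong (_+ 1) (count<-none P? n (λ k k<n Pk → <-irrefl (unique k (m<n⇒m<1+n k<n) Pk) k<n))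
  ... | yes refl | no ¬Pn = ⊥-elim (¬Pn Pr)
  ... | no r≢n   | yes Pn = ⊥-elim (r≢n (sym (unique n ≤-refl Pn)))
  ... | no r≢n   | no _   = trans (+-identityʳ _)
    (count<-unique P? n r (≤∧≢⇒< (≤-pred r<n) r≢n) Pr (λ k k<n → unique k (m<n⇒m<1+n k<n)))

  count<-multiples : ∀ r .{{_ : NonZero r}} s → count< (r ∣?_) (suc (s * r)) ≡ s + 1
  count<-multiples r s = begin
    count< (r ∣?_) (s * r) + indicator (r ∣? (s * r))
      ≡⟨ cong₂ _+_ (sum<-periodic _ r shift s) (indicator-yes (r ∣? (s * r)) (n∣m*n s)) ⟩
    s * count< (r ∣?_) r + 1   ≡⟨ cong (λ c → s * c + 1) one-multiple ⟩
    s * 1 + 1                  ≡⟨ cong (_+ 1) (*-identityʳ s) ⟩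
    s + 1                      ∎
    where
    shift : ∀ k → indicator (r ∣? (r + k)) ≡ indicator (r ∣? k)
    shift k = indicator-cong (r ∣? (r + k)) (r ∣? k) (mk⇔ (λ d → ∣m+n∣m⇒∣n d ∣-refl) (∣m∣n⇒∣m+n ∣-refl))
    one-multiple : count< (r ∣?_) r ≡ 1
    one-multiple = count<-unique (r ∣?_) r 0 (>-nonZero⁻¹ r) (divides 0 refl)
      (λ { zero _ _ → refl ; (suc k) k<r r∣k → ⊥-elim (<⇒≱ k<r (∣⇒≤ r∣k)) })

  module _ {A : ℕ → ℕ → Set} (A? : ∀ p q → Dec (A p q)) {m h m' : ℕ} .{{_ : NonZero h}} .{{_ : NonZero m'}}
    (periodic : ∀ p q → A (m + p) q ⇔ A p q)
    (unique   : ∀ p p' q → p < m → p' < m → A p q → A p' q → p ≡ p')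
    (exists   : ∀ q → h ∣ q → ∃ λ p → p < m × A p q)
    (only     : ∀ p q → A p q → h ∣ q)
    (on-axis  : ∀ q → A 0 q ⇔ m' ∣ q)
    where

    periodic-indicator : ∀ p q → indicator (A? (m + p) q) ≡ indicator (A? p q)
    periodic-indicator p q = indicator-cong (A? (m + p) q) (A? p q) (periodic p q)

    periodic-indicator-* : ∀ s q → indicator (A? (s * m) q) ≡ indicator (A? 0 q)
    periodic-indicator-* zero    q = refl
    periodic-indicator-* (suc s) q = trans (periodic-indicator (s * m) q) (periodic-indicator-* s q)

    -- The last column p = N = r·m behaves like p = 0.
    row-count : ∀ {N} r q → N ≡ r * m → count< (λ p → A? p q) (suc N) ≡ r * indicator (h ∣? q) + indicator (A? 0 q)
    row-count {N} r q refl = cong₂ _+_ full-periods (periodic-indicator-* r q)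
      where
      full-periods : count< (λ p → A? p q) (r * m) ≡ r * indicator (h ∣? q)
      full-periods with h ∣? q
      ... | no h∤q = trans (count<-none _ (r * m) (λ p _ Apq → h∤q (only p q Apq))) (sym (*-zeroʳ r))
      ... | yes h∣q with exists q h∣q
      ...   | p₀ , p₀<m , Ap₀q = begin
        count< (λ p → A? p q) (r * m) ≡⟨ sum<-periodic _ m (λ p → periodic-indicator p q) r ⟩
        r * count< (λ p → A? p q) m   ≡⟨ cong (r *_) (count<-unique _ m p₀ p₀<m Ap₀q (λ p p<m Apq → unique p p₀ q p<m p₀<m Apq Ap₀q)) ⟩
        r * 1                         ∎

    box-count : ∀ {N} r s s' → N ≡ r * m → N ≡ s * h → N ≡ s' * m' →
                sum< (λ q → count< (λ p → A? p q) (suc N)) (suc N) ≡ r * (s + 1) + (s' + 1)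
    box-count {N} r s s' N≡rm N≡sh N≡s'm' = begin
      sum< (λ q → count< (λ p → A? p q) (suc N)) (suc N)
        ≡⟨ sum<-cong _ _ (suc N) (λ q _ → row-count r q N≡rm) ⟩
      sum< (λ q → r * indicator (h ∣? q) + indicator (A? 0 q)) (suc N)
        ≡⟨ sum<-+ _ _ (suc N) ⟩
      sum< (λ q → r * indicator (h ∣? q)) (suc N) + count< (A? 0) (suc N)
        ≡⟨ cong₂ _+_ (sum<-* r _ (suc N)) (sum<-cong _ _ (suc N) (λ q _ → indicator-cong (A? 0 q) (m' ∣? q) (on-axis q))) ⟩
      r * count< (h ∣?_) (suc N) + count< (m' ∣?_) (suc N)
        ≡⟨ cong₂ (λ x y → r * count< (h ∣?_) (suc x) + count< (m' ∣?_) (suc y)) N≡sh N≡s'm' ⟩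
      r * count< (h ∣?_) (suc (s * h)) + count< (m' ∣?_) (suc (s' * m'))
        ≡⟨ cong₂ (λ x y → r * x + y) (count<-multiples h s) (count<-multiples m' s') ⟩
      r * (s + 1) + (s' + 1) ∎

module Enumeration where
  open import Data.Nat
  open import Data.Nat.Properties using (≤-refl; m<n⇒m<1+n; ≤∧≢⇒<; ≤-pred; <-irrefl; _≟_)
  open import Data.List using (List; []; _∷_; _++_; length; filter; map; upTo)
  open import Data.List.Properties using (length-++; length-map; filter-++; upTo-∷ʳ)
  open import Data.List.Membership.Propositional using (_∈_)
  open import Data.List.Membership.Propositional.Properties using (∈-++⁺ˡ; ∈-++⁺ʳ; ∈-++⁻; ∈-map⁺; ∈-map⁻; ∈-filter⁺; ∈-filter⁻; ∈-upTo⁺; ∈-upTo⁻)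
  open import Data.List.Relation.Unary.Unique.Propositional using (Unique)
  import Data.List.Relation.Unary.Unique.Propositional.Properties as Unique
  open import Data.List.Relation.Unary.All using (All; []; _∷_)
  open import Data.List.Relation.Unary.All.Properties using (all-filter)
  open import Data.List.Relation.Unary.AllPairs using ([]; _∷_)
  open import Relation.Nullary using (Dec; yes; no; ¬_)
  open import Relation.Unary using (Decidable)
  open Counting using (indicator; sum<; count<)
  open ≡-Reasoning

  length-filter-upTo : ∀ {P : ℕ → Set} (P? : Decidable P) n → length (filter P? (upTo n)) ≡ count< P? n
  length-filter-upTo P? zero    = refl
  length-filter-upTo P? (suc n) = begin
    length (filter P? (upTo (suc n)))                     ≡⟨ cong (λ xs → length (filter P? xs)) (sym (upTo-∷ʳ n)) ⟩
    length (filter P? (upTo n ++ n ∷ []))                 ≡⟨ cong length (filter-++ P? (upTo n) (n ∷ [])) ⟩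
    length (filter P? (upTo n) ++ filter P? (n ∷ []))     ≡⟨ length-++ (filter P? (upTo n)) ⟩
    length (filter P? (upTo n)) + length (filter P? (n ∷ [])) ≡⟨ cong₂ _+_ (length-filter-upTo P? n) singleton ⟩
    count< P? n + indicator (P? n)                        ∎
    where
    singleton : length (filter P? (n ∷ [])) ≡ indicator (P? n)
    singleton with P? n
    ... | yes _ = refl
    ... | no _  = refl

  Unique-map-on : ∀ {A B : Set} (P : A → Set) (f : A → B) → (∀ {x y} → P x → P y → f x ≡ f y → x ≡ y) →
                  ∀ {xs} → All P xs → Unique xs → Unique (map f xs)
  Unique-map-on P f injective [] [] = []
  Unique-map-on P f injective (px ∷ pxs) (x∉xs ∷ xs!) = distinct px pxs x∉xs ∷ Unique-map-on P f injective pxs xs!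
    where
    distinct : ∀ {x ys} → P x → All P ys → All (λ y → ¬ x ≡ y) ys → All (λ y → ¬ f x ≡ y) (map f ys)
    distinct px [] [] = []
    distinct px (py ∷ pys) (x≢y ∷ x≢ys) = (λ e → x≢y (injective px py e)) ∷ distinct px pys x≢ys

  module Grid {B : Set} {A : ℕ → ℕ → Set} (A? : ∀ p q → Dec (A p q)) (X : ℕ → ℕ → B) (M : ℕ)
    (X-injective : ∀ {p q p' q'} → A p q → A p' q' → X p q ≡ X p' q' → p ≡ p' × q ≡ q') where

    row : ℕ → List B
    row q = map (λ p → X p q) (filter (λ p → A? p q) (upTo M))

    rows : ℕ → List B
    rows zero    = []
    rows (suc n) = rows n ++ row n

    InGrid : ℕ → B → Set
    InGrid n x = ∃₂ λ p q → p < M × q < n × A p q × x ≡ X p q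

    length-rows : ∀ n → length (rows n) ≡ sum< (λ q → count< (λ p → A? p q) M) n
    length-rows zero    = refl
    length-rows (suc n) = begin
      length (rows n ++ row n)          ≡⟨ length-++ (rows n) ⟩
      length (rows n) + length (row n)  ≡⟨ cong₂ _+_ (length-rows n)
        (trans (length-map _ (filter (λ p → A? p n) (upTo M))) (length-filter-upTo (λ p → A? p n) M)) ⟩
      sum< (λ q → count< (λ p → A? p q) M) n + count< (λ p → A? p n) M ∎

    ∈-row⁻ : ∀ {x} q → x ∈ row q → ∃ λ p → p < M × A p q × x ≡ X p q
    ∈-row⁻ q x∈ with ∈-map⁻ (λ p → X p q) x∈
    ... | p , p∈ , refl with ∈-filter⁻ (λ p → A? p q) p∈
    ...   | p∈upTo , Apq = p , ∈-upTo⁻ p∈upTo , Apq , refl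

    ∈-rows⁻ : ∀ {x} n → x ∈ rows n → InGrid n x
    ∈-rows⁻ (suc n) x∈ with ∈-++⁻ (rows n) x∈
    ... | inj₁ x∈rows with ∈-rows⁻ n x∈rows
    ...   | p , q , p<M , q<n , Apq , e = p , q , p<M , m<n⇒m<1+n q<n , Apq , e
    ∈-rows⁻ (suc n) x∈ | inj₂ x∈row with ∈-row⁻ n x∈row
    ...   | p , p<M , Apn , e = p , n , p<M , ≤-refl , Apn , e

    ∈-rows⁺ : ∀ {x} n → InGrid n x → x ∈ rows n
    ∈-rows⁺ (suc n) (p , q , p<M , q<1+n , Apq , refl) with q ≟ n
    ... | yes refl = ∈-++⁺ʳ (rows n) (∈-map⁺ (λ p → X p q) (∈-filter⁺ (λ p → A? p q) (∈-upTo⁺ p<M) Apq))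
    ... | no q≢n   = ∈-++⁺ˡ (∈-rows⁺ n (p , q , p<M , ≤∧≢⇒< (≤-pred q<1+n) q≢n , Apq , refl))

    ∈-rows⇔ : ∀ n x → x ∈ rows n ⇔ InGrid n x
    ∈-rows⇔ n x = mk⇔ (∈-rows⁻ n) (∈-rows⁺ n)

    rows-unique : ∀ n → Unique (rows n)
    rows-unique zero    = []
    rows-unique (suc n) = Unique.++⁺ (rows-unique n) row-unique disjoint
      where
      row-unique : Unique (row n)
      row-unique = Unique-map-on (λ p → A p n) (λ p → X p n) (λ Apn Ap'n e → proj₁ (X-injective Apn Ap'n e))
        (all-filter (λ p → A? p n) (upTo M)) (Unique.filter⁺ (λ p → A? p n) (Unique.upTo⁺ M))
      disjoint : ∀ {x} → ¬ (x ∈ rows n × x ∈ row n)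
      disjoint (x∈rows , x∈row) with ∈-rows⁻ n x∈rows | ∈-row⁻ n x∈row
      ... | p , q , _ , q<n , Apq , e | p' , _ , Ap'n , e' = <-irrefl (proj₂ (X-injective Apq Ap'n (trans (sym e) e'))) q<n

module Rational where
  open import Data.Nat as ℕ using (ℕ; zero; suc)
  import Data.Nat.Properties as ℕ
  open import Data.Integer as ℤ using (ℤ; +_)
  import Data.Integer.Properties as ℤ
  open import Data.Rational.Base using (ℚ; _/_; 0ℚ; 1ℚ; _≤_)
  import Data.Rational.Base as ℚ
  import Data.Rational.Properties as ℚ
  open import Data.Rational.Unnormalised.Base using (mkℚᵘ; *≡*; *≤*)
  import Data.Rational.Unnormalised as ℚᵘ
  import Data.Rational.Unnormalised.Properties as ℚᵘ
  open import Data.Maybe using (Maybe; nothing; just)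
  open import Relation.Nullary using (yes; no)
  open import Level using (0ℓ)
  import Data.Nat.Tactic.RingSolver as ℕ-Solver
  open import Tactic.RingSolver using (solve-∀)
  import Data.Integer.Tactic.RingSolver as IntegerSolver
  open IntegerVectors using (_*³_)
  open import Tactic.RingSolver.Core.AlmostCommutativeRing using (AlmostCommutativeRing; fromCommutativeRing)
  open ≡-Reasoning

  ℚ-ring : AlmostCommutativeRing 0ℓ 0ℓ
  ℚ-ring = fromCommutativeRing ℚ.+-*-commutativeRing is-zero
    where is-zero : (x : ℚ) → Maybe (0ℚ ≡ x)
          is-zero x with 0ℚ ℚ.≟ x
          ... | yes e = just e
          ... | no _  = nothing

  private
    toℚᵘ-toℚ : ∀ i → ℚ.toℚᵘ (toℚ i) ℚᵘ.≃ mkℚᵘ i 0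
    toℚᵘ-toℚ i = ℚ.toℚᵘ-fromℚᵘ (mkℚᵘ i 0)

  toℚ-+ : ∀ i j → toℚ (i ℤ.+ j) ≡ toℚ i ℚ.+ toℚ j
  toℚ-+ i j = ℚ.toℚᵘ-injective (ℚᵘ.≃-trans (toℚᵘ-toℚ (i ℤ.+ j)) (ℚᵘ.≃-trans (*≡* (normalise i j))
    (ℚᵘ.≃-sym (ℚᵘ.≃-trans (ℚ.toℚᵘ-homo-+ (toℚ i) (toℚ j)) (ℚᵘ.+-cong (toℚᵘ-toℚ i) (toℚᵘ-toℚ j))))))
    where normalise : ∀ i j → (i ℤ.+ j) ℤ.* + 1 ≡ (i ℤ.* + 1 ℤ.+ j ℤ.* + 1) ℤ.* + 1
          normalise = IntegerSolver.solve-∀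

  toℚ-* : ∀ i j → toℚ (i ℤ.* j) ≡ toℚ i ℚ.* toℚ j
  toℚ-* i j = ℚ.toℚᵘ-injective (ℚᵘ.≃-trans (toℚᵘ-toℚ (i ℤ.* j))
    (ℚᵘ.≃-sym (ℚᵘ.≃-trans (ℚ.toℚᵘ-homo-* (toℚ i) (toℚ j)) (ℚᵘ.*-cong (toℚᵘ-toℚ i) (toℚᵘ-toℚ j)))))

  toℚ-injective : ∀ {i j} → toℚ i ≡ toℚ j → i ≡ j
  toℚ-injective {i} {j} eq with ℚᵘ.≃-trans (ℚᵘ.≃-sym (toℚᵘ-toℚ i)) (ℚᵘ.≃-trans (ℚᵘ.≃-reflexive (cong ℚ.toℚᵘ eq)) (toℚᵘ-toℚ j))
  ... | *≡* i*1≡j*1 = trans (sym (ℤ.*-identityʳ i)) (trans i*1≡j*1 (ℤ.*-identityʳ j))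

  toℚ-mono-≤ : ∀ {i j} → i ℤ.≤ j → toℚ i ≤ toℚ j
  toℚ-mono-≤ {i} {j} i≤j = ℚ.toℚᵘ-cancel-≤ (ℚᵘ.≤-respˡ-≃ (ℚᵘ.≃-sym (toℚᵘ-toℚ i)) (ℚᵘ.≤-respʳ-≃ (ℚᵘ.≃-sym (toℚᵘ-toℚ j))
    (*≤* (subst₂ ℤ._≤_ (sym (ℤ.*-identityʳ i)) (sym (ℤ.*-identityʳ j)) i≤j))))

  toℚ-cancel-≤ : ∀ {i j} → toℚ i ≤ toℚ j → i ℤ.≤ j
  toℚ-cancel-≤ {i} {j} le with ℚᵘ.≤-respˡ-≃ (toℚᵘ-toℚ i) (ℚᵘ.≤-respʳ-≃ (toℚᵘ-toℚ j) (ℚ.toℚᵘ-mono-≤ le))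
  ... | *≤* i*1≤j*1 = subst₂ ℤ._≤_ (ℤ.*-identityʳ i) (ℤ.*-identityʳ j) i*1≤j*1

  toℚ-nonNeg : ∀ n → 0ℚ ≤ toℚ (+ n)
  toℚ-nonNeg n = toℚ-mono-≤ {+ 0} {+ n} (ℤ.+≤+ ℕ.z≤n)

  1/ℕ : (n : ℕ) → .{{ℕ.NonZero n}} → ℚ
  1/ℕ n = + 1 / n

  1/ℕ-nonNeg : ∀ n .{{_ : ℕ.NonZero n}} → 0ℚ ≤ 1/ℕ n
  1/ℕ-nonNeg n = ℚ.nonNegative⁻¹ (1/ℕ n) {{ℚ.normalize-nonNeg 1 n}}

  *-1/ℕ : ∀ n .{{_ : ℕ.NonZero n}} → toℚ (+ n) ℚ.* 1/ℕ n ≡ 1ℚ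
  *-1/ℕ (suc n) = ℚ.toℚᵘ-injective (ℚᵘ.≃-trans (ℚ.toℚᵘ-homo-* (toℚ (+ suc n)) (1/ℕ (suc n)))
    (ℚᵘ.≃-trans (ℚᵘ.*-cong (toℚᵘ-toℚ (+ suc n)) (ℚ.toℚᵘ-fromℚᵘ (mkℚᵘ (+ 1) n))) (*≡* (cross-multiplied n))))
    where
    cross-multiplied : ∀ n → ℚᵘ.↥ (mkℚᵘ (+ suc n) 0 ℚᵘ.* mkℚᵘ (+ 1) n) ℤ.* ℚᵘ.↧ (ℚ.toℚᵘ 1ℚ) ≡
                             ℚᵘ.↥ (ℚ.toℚᵘ 1ℚ) ℤ.* ℚᵘ.↧ (mkℚᵘ (+ suc n) 0 ℚᵘ.* mkℚᵘ (+ 1) n)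
    cross-multiplied n = cong (λ k → + suc k) (normalise n)
      where normalise : ∀ n → n ℕ.* 1 ℕ.* 1 ≡ n ℕ.+ 0 ℕ.+ 0
            normalise = ℕ-Solver.solve-∀

  0≤* : ∀ {p q} → 0ℚ ≤ p → 0ℚ ≤ q → 0ℚ ≤ p ℚ.* q
  0≤* {p} {q} 0≤p 0≤q = subst (_≤ p ℚ.* q) (ℚ.*-zeroʳ p) (ℚ.*-monoˡ-≤-nonNeg p {{ℚ.nonNegative 0≤p}} 0≤q)

  0≤+ : ∀ {p q} → 0ℚ ≤ p → 0ℚ ≤ q → 0ℚ ≤ p ℚ.+ q
  0≤+ = ℚ.+-mono-≤

  *-monoˡ-≤ : ∀ {r p q} → 0ℚ ≤ r → p ≤ q → r ℚ.* p ≤ r ℚ.* q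
  *-monoˡ-≤ {r} 0≤r = ℚ.*-monoˡ-≤-nonNeg r {{ℚ.nonNegative 0≤r}}

  *-monoʳ-≤ : ∀ {r p q} → 0ℚ ≤ r → p ≤ q → p ℚ.* r ≤ q ℚ.* r
  *-monoʳ-≤ {r} 0≤r = ℚ.*-monoʳ-≤-nonNeg r {{ℚ.nonNegative 0≤r}}

  p≤p+q : ∀ {p q} → 0ℚ ≤ q → p ≤ p ℚ.+ q
  p≤p+q {p} {q} 0≤q = subst (_≤ p ℚ.+ q) (ℚ.+-identityʳ p) (ℚ.+-monoʳ-≤ p 0≤q)

  toℚ-dot : ∀ x y → toℚ (dot x y) ≡ toℚ (proj₁ x) ℚ.* toℚ (proj₁ y) ℚ.+ toℚ (proj₁ (proj₂ x)) ℚ.* toℚ (proj₁ (proj₂ y)) ℚ.+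
                                    toℚ (proj₂ (proj₂ x)) ℚ.* toℚ (proj₂ (proj₂ y))
  toℚ-dot (a , b , c) (a' , b' , c') = trans (toℚ-+ (a ℤ.* a' ℤ.+ b ℤ.* b') (c ℤ.* c'))
    (cong₂ ℚ._+_ (trans (toℚ-+ (a ℤ.* a') (b ℤ.* b')) (cong₂ ℚ._+_ (toℚ-* a a') (toℚ-* b b'))) (toℚ-* c c'))

  vertex-combination : ∀ λ₀ λ₁ λ₂ λ₃ u v →
    (λ₀ ⊙ ι (+ 0 , + 0 , + 0)) ⊕ ((λ₁ ⊙ ι u) ⊕ ((λ₂ ⊙ ι v) ⊕ (λ₃ ⊙ ι (u +³ v)))) ≡ ((λ₁ ℚ.+ λ₃) ⊙ ι u) ⊕ ((λ₂ ℚ.+ λ₃) ⊙ ι v)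
  vertex-combination λ₀ λ₁ λ₂ λ₃ (a , b , c) (a' , b' , c') = cong³ (coord a a') (coord b b') (coord c c')
    where
    collect : ∀ l₀ l₁ l₂ l₃ A A' → l₀ ℚ.* 0ℚ ℚ.+ (l₁ ℚ.* A ℚ.+ (l₂ ℚ.* A' ℚ.+ l₃ ℚ.* (A ℚ.+ A'))) ≡ (l₁ ℚ.+ l₃) ℚ.* A ℚ.+ (l₂ ℚ.+ l₃) ℚ.* A'
    collect = solve-∀ ℚ-ring
    coord : ∀ A A' → λ₀ ℚ.* 0ℚ ℚ.+ (λ₁ ℚ.* toℚ A ℚ.+ (λ₂ ℚ.* toℚ A' ℚ.+ λ₃ ℚ.* toℚ (A ℤ.+ A'))) ≡
                     (λ₁ ℚ.+ λ₃) ℚ.* toℚ A ℚ.+ (λ₂ ℚ.+ λ₃) ℚ.* toℚ A'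
    coord A A' = trans (cong (λ S → λ₀ ℚ.* 0ℚ ℚ.+ (λ₁ ℚ.* toℚ A ℚ.+ (λ₂ ℚ.* toℚ A' ℚ.+ λ₃ ℚ.* S))) (toℚ-+ A A'))
                       (collect λ₀ λ₁ λ₂ λ₃ (toℚ A) (toℚ A'))

  q+s≤1 : ∀ {p q r s} → 0ℚ ≤ p → 0ℚ ≤ r → p ℚ.+ q ℚ.+ r ℚ.+ s ≡ 1ℚ → q ℚ.+ s ≤ 1ℚ
  q+s≤1 {p} {q} {r} {s} 0≤p 0≤r Σ≡1 = subst (q ℚ.+ s ≤_) (trans (regroup p q r s) Σ≡1) (p≤p+q (0≤+ 0≤p 0≤r))
    where regroup : ∀ p q r s → q ℚ.+ s ℚ.+ (p ℚ.+ r) ≡ p ℚ.+ q ℚ.+ r ℚ.+ s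
          regroup = solve-∀ ℚ-ring

  r+s≤1 : ∀ {p q r s} → 0ℚ ≤ p → 0ℚ ≤ q → p ℚ.+ q ℚ.+ r ℚ.+ s ≡ 1ℚ → r ℚ.+ s ≤ 1ℚ
  r+s≤1 {p} {q} {r} {s} 0≤p 0≤q Σ≡1 = q+s≤1 0≤p 0≤q (trans (swap p q r s) Σ≡1)
    where swap : ∀ p q r s → p ℚ.+ r ℚ.+ q ℚ.+ s ≡ p ℚ.+ q ℚ.+ r ℚ.+ s
          swap = solve-∀ ℚ-ring

  0≤q-p : ∀ {p q} → p ≤ q → 0ℚ ≤ q ℚ.- p
  0≤q-p {p} {q} p≤q = subst (_≤ q ℚ.- p) (ℚ.+-inverseʳ p) (ℚ.+-monoˡ-≤ (ℚ.- p) p≤q)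

  -- The point s·u + r·v has the bilinear weights (1-s)(1-r), s(1-r), (1-s)r, sr at the vertices 0, u, v, u + v.
  in-square⇔ : ∀ u v y → InSquare u v y ⇔
               ∃₂ λ s r → (0ℚ ≤ s × s ≤ 1ℚ) × (0ℚ ≤ r × r ≤ 1ℚ) × y ≡ (s ⊙ ι u) ⊕ (r ⊙ ι v)
  in-square⇔ u v y = mk⇔ to from
    where
    to : InSquare u v y → ∃₂ λ s r → (0ℚ ≤ s × s ≤ 1ℚ) × (0ℚ ≤ r × r ≤ 1ℚ) × y ≡ (s ⊙ ι u) ⊕ (r ⊙ ι v)
    to (λ₀ , λ₁ , λ₂ , λ₃ , 0≤λ₀ , 0≤λ₁ , 0≤λ₂ , 0≤λ₃ , Σλ≡1 , y≡) =
      λ₁ ℚ.+ λ₃ , λ₂ ℚ.+ λ₃ , (0≤+ 0≤λ₁ 0≤λ₃ , q+s≤1 0≤λ₀ 0≤λ₂ Σλ≡1) , (0≤+ 0≤λ₂ 0≤λ₃ , r+s≤1 0≤λ₀ 0≤λ₁ Σλ≡1) ,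
      trans y≡ (vertex-combination λ₀ λ₁ λ₂ λ₃ u v)
    from : (∃₂ λ s r → (0ℚ ≤ s × s ≤ 1ℚ) × (0ℚ ≤ r × r ≤ 1ℚ) × y ≡ (s ⊙ ι u) ⊕ (r ⊙ ι v)) → InSquare u v y
    from (s , r , (0≤s , s≤1) , (0≤r , r≤1) , y≡) =
      (1ℚ ℚ.- s) ℚ.* (1ℚ ℚ.- r) , s ℚ.* (1ℚ ℚ.- r) , (1ℚ ℚ.- s) ℚ.* r , s ℚ.* r ,
      0≤* (0≤q-p s≤1) (0≤q-p r≤1) , 0≤* 0≤s (0≤q-p r≤1) , 0≤* (0≤q-p s≤1) 0≤r , 0≤* 0≤s 0≤r , partition s r ,
      trans y≡ (sym (trans (vertex-combination ((1ℚ ℚ.- s) ℚ.* (1ℚ ℚ.- r)) (s ℚ.* (1ℚ ℚ.- r)) ((1ℚ ℚ.- s) ℚ.* r) (s ℚ.* r) u v) (cong₂ (λ α β → (α ⊙ ι u) ⊕ (β ⊙ ι v)) (first s r) (second s r))))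
      where
      partition : ∀ s r → (1ℚ ℚ.- s) ℚ.* (1ℚ ℚ.- r) ℚ.+ s ℚ.* (1ℚ ℚ.- r) ℚ.+ (1ℚ ℚ.- s) ℚ.* r ℚ.+ s ℚ.* r ≡ 1ℚ
      partition = solve-∀ ℚ-ring
      first : ∀ s r → s ℚ.* (1ℚ ℚ.- r) ℚ.+ s ℚ.* r ≡ s
      first = solve-∀ ℚ-ring
      second : ∀ s r → (1ℚ ℚ.- s) ℚ.* r ℚ.+ s ℚ.* r ≡ r
      second = solve-∀ ℚ-ring

  toℚ-dot-dilated : ∀ T s r x u v → ι x ≡ T ⊙ ((s ⊙ ι u) ⊕ (r ⊙ ι v)) →
                    ∀ z → toℚ (dot x z) ≡ T ℚ.* (s ℚ.* toℚ (dot u z) ℚ.+ r ℚ.* toℚ (dot v z))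
  toℚ-dot-dilated T s r (x₁ , x₂ , x₃) (a , b , c) (a' , b' , c') x≡ (z₁ , z₂ , z₃) = begin
    toℚ (dot (x₁ , x₂ , x₃) (z₁ , z₂ , z₃))
      ≡⟨ toℚ-dot (x₁ , x₂ , x₃) (z₁ , z₂ , z₃) ⟩
    toℚ x₁ ℚ.* Z₁ ℚ.+ toℚ x₂ ℚ.* Z₂ ℚ.+ toℚ x₃ ℚ.* Z₃
      ≡⟨ cong₂ (λ P Q → P ℚ.+ Q ℚ.* Z₃) (cong₂ (λ P Q → P ℚ.* Z₁ ℚ.+ Q ℚ.* Z₂) (cong proj₁ x≡) (cong (λ w → proj₁ (proj₂ w)) x≡))
               (cong (λ w → proj₂ (proj₂ w)) x≡) ⟩
    T ℚ.* (s ℚ.* toℚ a ℚ.+ r ℚ.* toℚ a') ℚ.* Z₁ ℚ.+ T ℚ.* (s ℚ.* toℚ b ℚ.+ r ℚ.* toℚ b') ℚ.* Z₂ ℚ.+ T ℚ.* (s ℚ.* toℚ c ℚ.+ r ℚ.* toℚ c') ℚ.* Z₃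
      ≡⟨ regroup T s r (toℚ a) (toℚ b) (toℚ c) (toℚ a') (toℚ b') (toℚ c') Z₁ Z₂ Z₃ ⟩
    T ℚ.* (s ℚ.* (toℚ a ℚ.* Z₁ ℚ.+ toℚ b ℚ.* Z₂ ℚ.+ toℚ c ℚ.* Z₃) ℚ.+ r ℚ.* (toℚ a' ℚ.* Z₁ ℚ.+ toℚ b' ℚ.* Z₂ ℚ.+ toℚ c' ℚ.* Z₃))
      ≡⟨ sym (cong₂ (λ P Q → T ℚ.* (s ℚ.* P ℚ.+ r ℚ.* Q)) (toℚ-dot (a , b , c) (z₁ , z₂ , z₃)) (toℚ-dot (a' , b' , c') (z₁ , z₂ , z₃))) ⟩
    T ℚ.* (s ℚ.* toℚ (dot (a , b , c) (z₁ , z₂ , z₃)) ℚ.+ r ℚ.* toℚ (dot (a' , b' , c') (z₁ , z₂ , z₃))) ∎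
    where
    Z₁ = toℚ z₁
    Z₂ = toℚ z₂
    Z₃ = toℚ z₃
    regroup : ∀ T s r a b c a' b' c' z₁ z₂ z₃ →
      T ℚ.* (s ℚ.* a ℚ.+ r ℚ.* a') ℚ.* z₁ ℚ.+ T ℚ.* (s ℚ.* b ℚ.+ r ℚ.* b') ℚ.* z₂ ℚ.+ T ℚ.* (s ℚ.* c ℚ.+ r ℚ.* c') ℚ.* z₃ ≡
      T ℚ.* (s ℚ.* (a ℚ.* z₁ ℚ.+ b ℚ.* z₂ ℚ.+ c ℚ.* z₃) ℚ.+ r ℚ.* (a' ℚ.* z₁ ℚ.+ b' ℚ.* z₂ ℚ.+ c' ℚ.* z₃))
    regroup = solve-∀ ℚ-ring

  -- For t > 0 the coefficients are s = p/N and r = q/N with N = tℓ.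
  dilate-of-combination : ∀ t ℓ .{{_ : ℕ.NonZero ℓ}} p q x u v → p ℕ.≤ t ℕ.* ℓ → q ℕ.≤ t ℕ.* ℓ →
    (+ ℓ) *³ x ≡ (+ p) *³ u +³ (+ q) *³ v →
    ∃₂ λ s r → (0ℚ ≤ s × s ≤ 1ℚ) × (0ℚ ≤ r × r ≤ 1ℚ) × ι x ≡ toℚ (+ t) ⊙ ((s ⊙ ι u) ⊕ (r ⊙ ι v))
  dilate-of-combination zero ℓ p q (x₁ , x₂ , x₃) (a , b , c) (a' , b' , c') p≤0 q≤0 ℓx≡pu+qv
    with ℕ.n≤0⇒n≡0 p≤0 | ℕ.n≤0⇒n≡0 q≤0
  ... | refl | refl = 0ℚ , 0ℚ , (ℚ.≤-refl , toℚ-nonNeg 1) , (ℚ.≤-refl , toℚ-nonNeg 1) ,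
    cong³ (vanishes {x₁} {a} {a'} (cong proj₁ ℓx≡pu+qv)) (vanishes {x₂} {b} {b'} (cong (λ w → proj₁ (proj₂ w)) ℓx≡pu+qv))
          (vanishes {x₃} {c} {c'} (cong (λ w → proj₂ (proj₂ w)) ℓx≡pu+qv))
    where
    vanishes : ∀ {X A A'} → + ℓ ℤ.* X ≡ + 0 ℤ.* A ℤ.+ + 0 ℤ.* A' → toℚ X ≡ 0ℚ ℚ.* (0ℚ ℚ.* toℚ A ℚ.+ 0ℚ ℚ.* toℚ A')
    vanishes {X} {A} {A'} eq = trans (cong toℚ (ℤ.*-cancelˡ-≡ (+ ℓ) X (+ 0) (trans eq (zeros A A' (+ ℓ))))) (annihilate (toℚ A) (toℚ A'))
      where zeros : ∀ A A' l → + 0 ℤ.* A ℤ.+ + 0 ℤ.* A' ≡ l ℤ.* + 0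
            zeros = IntegerSolver.solve-∀
            annihilate : ∀ A A' → 0ℚ ≡ 0ℚ ℚ.* (0ℚ ℚ.* A ℚ.+ 0ℚ ℚ.* A')
            annihilate = solve-∀ ℚ-ring
  dilate-of-combination t@(suc _) ℓ p q (x₁ , x₂ , x₃) (a , b , c) (a' , b' , c') p≤N q≤N ℓx≡pu+qv =
    s , r , fraction-bounds p≤N , fraction-bounds q≤N ,
    cong³ (coordinate {x₁} {a} {a'} (cong proj₁ ℓx≡pu+qv)) (coordinate {x₂} {b} {b'} (cong (λ w → proj₁ (proj₂ w)) ℓx≡pu+qv))
          (coordinate {x₃} {c} {c'} (cong (λ w → proj₂ (proj₂ w)) ℓx≡pu+qv))
    where
    N = t ℕ.* ℓ
    instance
      N≢0 : ℕ.NonZero N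
      N≢0 = ℕ.m*n≢0 t ℓ
    T = toℚ (+ t)
    ν = 1/ℕ N
    s = toℚ (+ p) ℚ.* ν
    r = toℚ (+ q) ℚ.* ν

    fraction-bounds : ∀ {k} → k ℕ.≤ N → 0ℚ ≤ toℚ (+ k) ℚ.* ν × toℚ (+ k) ℚ.* ν ≤ 1ℚ
    fraction-bounds {k} k≤N = 0≤* (toℚ-nonNeg k) (1/ℕ-nonNeg N) ,
      subst (toℚ (+ k) ℚ.* ν ≤_) (*-1/ℕ N) (*-monoʳ-≤ (1/ℕ-nonNeg N) (toℚ-mono-≤ (ℤ.+≤+ k≤N)))

    T*ℓ≡N : T ℚ.* toℚ (+ ℓ) ≡ toℚ (+ N)
    T*ℓ≡N = trans (sym (toℚ-* (+ t) (+ ℓ))) (cong toℚ (sym (ℤ.pos-* t ℓ)))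

    coordinate : ∀ {X A A'} → + ℓ ℤ.* X ≡ + p ℤ.* A ℤ.+ + q ℤ.* A' → toℚ X ≡ T ℚ.* (s ℚ.* toℚ A ℚ.+ r ℚ.* toℚ A')
    coordinate {X} {A} {A'} ℓX≡pA+qA' = sym (begin
      T ℚ.* (s ℚ.* toℚ A ℚ.+ r ℚ.* toℚ A')                           ≡⟨ factor T (toℚ (+ p)) (toℚ (+ q)) ν (toℚ A) (toℚ A') ⟩
      T ℚ.* ν ℚ.* (toℚ (+ p) ℚ.* toℚ A ℚ.+ toℚ (+ q) ℚ.* toℚ A')      ≡⟨ cong (T ℚ.* ν ℚ.*_) (sym (trans (toℚ-+ (+ p ℤ.* A) (+ q ℤ.* A'))
                                                                                                     (cong₂ ℚ._+_ (toℚ-* (+ p) A) (toℚ-* (+ q) A')))) ⟩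
      T ℚ.* ν ℚ.* toℚ (+ p ℤ.* A ℤ.+ + q ℤ.* A')                      ≡⟨ cong (λ z → T ℚ.* ν ℚ.* toℚ z) (sym ℓX≡pA+qA') ⟩
      T ℚ.* ν ℚ.* toℚ (+ ℓ ℤ.* X)                                      ≡⟨ cong (T ℚ.* ν ℚ.*_) (toℚ-* (+ ℓ) X) ⟩
      T ℚ.* ν ℚ.* (toℚ (+ ℓ) ℚ.* toℚ X)                                ≡⟨ regroup T ν (toℚ (+ ℓ)) (toℚ X) ⟩
      T ℚ.* toℚ (+ ℓ) ℚ.* ν ℚ.* toℚ X                                  ≡⟨ cong (λ z → z ℚ.* ν ℚ.* toℚ X) T*ℓ≡N ⟩
      toℚ (+ N) ℚ.* ν ℚ.* toℚ X                                        ≡⟨ cong (ℚ._* toℚ X) (*-1/ℕ N) ⟩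
      1ℚ ℚ.* toℚ X                                                     ≡⟨ ℚ.*-identityˡ (toℚ X) ⟩
      toℚ X                                                            ∎)
      where
      factor : ∀ T P Q ν A A' → T ℚ.* (P ℚ.* ν ℚ.* A ℚ.+ Q ℚ.* ν ℚ.* A') ≡ T ℚ.* ν ℚ.* (P ℚ.* A ℚ.+ Q ℚ.* A')
      factor = solve-∀ ℚ-ring
      regroup : ∀ T ν l X → T ℚ.* ν ℚ.* (l ℚ.* X) ≡ T ℚ.* l ℚ.* ν ℚ.* X
      regroup = solve-∀ ℚ-ring

module Square (u v : ℤ³) (|u|²≡|v|² : dot u u ≡ dot v v) (|u|²>0 : dot u u ℤ.> ℤ.+ 0)
               (u⊥v : dot u v ≡ ℤ.+ 0) (coprime : gcd⁶ u v ≡ 1) where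
  open import Data.Nat as ℕ using (ℕ; suc; NonZero)
  import Data.Nat.Properties as ℕ
  import Data.Nat.Divisibility as ℕ
  open import Data.Nat.GCD using (gcd; c*gcd[m,n]≡gcd[cm,cn]; gcd-greatest)
  open import Data.Integer as ℤ using (ℤ; +_; -_; -1ℤ; _+_; _*_; _-_; ∣_∣; _/ℕ_; _%ℕ_; _≤_)
  import Data.Integer.Properties as ℤ
  open import Data.Integer.Divisibility.Signed using (_∣_; ∣ᵤ⇒∣; ∣⇒∣ᵤ; ∣-refl; ∣n⇒∣m*n)
  open import Data.Integer.DivMod using (a≡a%ℕn+[a/ℕn]*n; n%ℕd<d)
  open import Data.Integer.Tactic.RingSolver using (solve-∀)
  open import Data.Rational.Base using (0ℚ; 1ℚ)
  import Data.Rational.Properties as ℚ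
  import Data.Rational.Base as ℚ
  open import Tactic.RingSolver using () renaming (solve-∀ to solve-∀ℚ)
  open import Data.Nat.Tactic.RingSolver using () renaming (solve-∀ to solve-∀ℕ)
  open import Function.Bundles using (module Equivalence)
  open IntegerVectors
  open VectorDivisibility
  open Counting using (sum<; count<; box-count)
  open Rational
  open ≡-Reasoning

  n : ℤ³
  n = u ⨯ v

  L : ℕ
  L = ∣ dot u u ∣

  instance
    L≢0 : NonZero L
    L≢0 = ℤ.>-nonZero |u|²>0

  |u|²≡L : dot u u ≡ + L
  |u|²≡L = sym (ℤ.0≤i⇒+∣i∣≡i (ℤ.<⇒≤ |u|²>0))

  |v|²≡L : dot v v ≡ + L
  |v|²≡L = trans (sym |u|²≡|v|²) |u|²≡L

  v⊥u : dot v u ≡ + 0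
  v⊥u = trans (dot-comm v u) u⊥v

  Admissible : ℤ → ℤ → Set
  Admissible P Q = + L ∣³ P *³ u +³ Q *³ v

  admissible? : ∀ p q → Dec (Admissible (+ p) (+ q))
  admissible? p q = + L ∣³? _

  admissible-in-plane : ∀ x → dot x n ≡ + 0 → Admissible (dot x u) (dot x v)
  admissible-in-plane x x⊥n = subst (+ L ∣³_) (plane-expansion u v x (+ L) |u|²≡L |v|²≡L u⊥v x⊥n) (∣³-refl-*³ (+ L) x)

  point : ℕ → ℕ → ℤ³
  point p q = ((+ p) *³ u +³ (+ q) *³ v) /³ L

  module _ (p q : ℕ) (adm : Admissible (+ p) (+ q)) where

    dot-point : ∀ w → + L * dot (point p q) w ≡ + p * dot u w + + q * dot v w
    dot-point w = begin
      + L * dot (point p q) w                    ≡⟨ sym (dot-*³ˡ (+ L) (point p q) w) ⟩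
      dot ((+ L) *³ point p q) w                 ≡⟨ cong (λ y → dot y w) (/³-exact L _ adm) ⟩
      dot ((+ p) *³ u +³ (+ q) *³ v) w           ≡⟨ dot-+³ˡ (+ p) (+ q) u v w ⟩
      + p * dot u w + + q * dot v w              ∎

    point-u : dot (point p q) u ≡ + p
    point-u = ℤ.*-cancelˡ-≡ (+ L) _ _ (begin
      + L * dot (point p q) u          ≡⟨ dot-point u ⟩
      + p * dot u u + + q * dot v u    ≡⟨ cong₂ (λ α β → + p * α + + q * β) |u|²≡L v⊥u ⟩
      + p * + L + + q * + 0            ≡⟨ first (+ p) (+ q) (+ L) ⟩
      + L * + p                        ∎)
      where first : ∀ p q L → p * L + q * + 0 ≡ L * p
            first = solve-∀

    point-v : dot (point p q) v ≡ + q
    point-v = ℤ.*-cancelˡ-≡ (+ L) _ _ (begin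
      + L * dot (point p q) v          ≡⟨ dot-point v ⟩
      + p * dot u v + + q * dot v v    ≡⟨ cong₂ (λ α β → + p * α + + q * β) u⊥v |v|²≡L ⟩
      + p * + 0 + + q * + L            ≡⟨ second (+ p) (+ q) (+ L) ⟩
      + L * + q                        ∎)
      where second : ∀ p q L → p * + 0 + q * L ≡ L * q
            second = solve-∀

    point-n : dot (point p q) n ≡ + 0
    point-n = ℤ.*-cancelˡ-≡ (+ L) _ _ (begin
      + L * dot (point p q) n          ≡⟨ dot-point n ⟩
      + p * dot u n + + q * dot v n    ≡⟨ cong₂ (λ α β → + p * α + + q * β) (dot-⨯ˡ u v) (dot-⨯ʳ u v) ⟩
      + p * + 0 + + q * + 0            ≡⟨ neither (+ p) (+ q) (+ L) ⟩
      + L * + 0                        ∎)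
      where neither : ∀ p q L → p * + 0 + q * + 0 ≡ L * + 0
            neither = solve-∀

  point-injective : ∀ {p q p' q'} → Admissible (+ p) (+ q) → Admissible (+ p') (+ q') → point p q ≡ point p' q' → p ≡ p' × q ≡ q'
  point-injective {p} {q} {p'} {q'} adm adm' eq =
    ℤ.+-injective (trans (sym (point-u p q adm)) (trans (cong (λ y → dot y u) eq) (point-u p' q' adm'))) ,
    ℤ.+-injective (trans (sym (point-v p q adm)) (trans (cong (λ y → dot y v) eq) (point-v p' q' adm')))

  InBox : ℕ → ℤ³ → Set
  InBox N x = dot x n ≡ + 0 × (+ 0 ≤ dot x u × dot x u ≤ + N) × (+ 0 ≤ dot x v × dot x v ≤ + N)

  module Grid (N : ℕ) = Enumeration.Grid admissible? point (suc N) point-injective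

  in-grid⇔in-box : ∀ N x → Grid.InGrid N (suc N) x ⇔ InBox N x
  in-grid⇔in-box N x = mk⇔ grid→box box→grid
    where
    coordinate : ∀ {i} → + 0 ≤ i → i ≤ + N → + ∣ i ∣ ≡ i × ∣ i ∣ ℕ.< suc N
    coordinate 0≤i i≤N = ℤ.0≤i⇒+∣i∣≡i 0≤i , ℕ.s≤s (ℤ.drop‿+≤+ (subst (_≤ + N) (sym (ℤ.0≤i⇒+∣i∣≡i 0≤i)) i≤N))
    box→grid : InBox N x → Grid.InGrid N (suc N) x
    box→grid (x⊥n , (0≤xu , xu≤N) , (0≤xv , xv≤N)) with coordinate 0≤xu xu≤N | coordinate 0≤xv xv≤N
    ... | p≡xu , p<N+1 | q≡xv , q<N+1 = ∣ dot x u ∣ , ∣ dot x v ∣ , p<N+1 , q<N+1 , adm , (begin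
      x                                                         ≡⟨ sym (*³-/³ L x) ⟩
      ((+ L) *³ x) /³ L                                          ≡⟨ cong (_/³ L) (plane-expansion u v x (+ L) |u|²≡L |v|²≡L u⊥v x⊥n) ⟩
      (dot x u *³ u +³ dot x v *³ v) /³ L                        ≡⟨ cong₂ (λ P Q → (P *³ u +³ Q *³ v) /³ L) (sym p≡xu) (sym q≡xv) ⟩
      point ∣ dot x u ∣ ∣ dot x v ∣                              ∎)
      where adm = subst₂ Admissible (sym p≡xu) (sym q≡xv) (admissible-in-plane x x⊥n)
    grid→box : Grid.InGrid N (suc N) x → InBox N x
    grid→box (p , q , p<N+1 , q<N+1 , adm , refl) =
      point-n p q adm ,
      (subst (+ 0 ≤_) (sym (point-u p q adm)) (ℤ.+≤+ ℕ.z≤n) , subst (_≤ + N) (sym (point-u p q adm)) (ℤ.+≤+ (ℕ.≤-pred p<N+1))) ,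
      (subst (+ 0 ≤_) (sym (point-v p q adm)) (ℤ.+≤+ ℕ.z≤n) , subst (_≤ + N) (sym (point-v p q adm)) (ℤ.+≤+ (ℕ.≤-pred q<N+1)))

  d d' D : ℕ
  d  = gcd³ u
  d' = gcd³ v
  D  = gcd³ n

  d∣L : d ℕ.∣ L
  d∣L = ∣⇒∣ᵤ (∣³⇒∣dot u u (gcd³∣³ u))

  d'∣L : d' ℕ.∣ L
  d'∣L = subst (d' ℕ.∣_) (cong ∣_∣ (sym |u|²≡|v|²)) (∣⇒∣ᵤ (∣³⇒∣dot v v (gcd³∣³ v)))

  d∣D : d ℕ.∣ D
  d∣D = gcd³-greatest n (∣³-⨯ˡ u v (gcd³∣³ u))

  v⨯n≡L*u : v ⨯ n ≡ (+ L) *³ u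
  v⨯n≡L*u = begin
    v ⨯ (u ⨯ v)                       ≡⟨ ⨯-⨯ʳ v u v ⟩
    dot v v *³ u -³ dot v u *³ v      ≡⟨ cong₂ (λ α β → α *³ u -³ β *³ v) |v|²≡L v⊥u ⟩
    (+ L) *³ u -³ (+ 0) *³ v          ≡⟨ *³--³-zeroʳ (+ L) u v ⟩
    (+ L) *³ u                        ∎

  u⨯n≡-L*v : u ⨯ n ≡ (- + L) *³ v
  u⨯n≡-L*v = begin
    u ⨯ (u ⨯ v)                       ≡⟨ ⨯-⨯ʳ u u v ⟩
    dot u v *³ u -³ dot u u *³ v      ≡⟨ cong₂ (λ α β → α *³ u -³ β *³ v) u⊥v |u|²≡L ⟩
    (+ 0) *³ u -³ (+ L) *³ v          ≡⟨ *³--³-zeroˡ (+ L) u v ⟩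
    (- + L) *³ v                      ∎

  D∣L : D ℕ.∣ L
  D∣L = subst (D ℕ.∣_) gcd[Ld,Ld']≡L (gcd-greatest (D∣gcd³ {v} {+ L} {u} v⨯n≡L*u refl) (D∣gcd³ {w = u} {k = - + L} {x = v} u⨯n≡-L*v (ℤ.∣-i∣≡∣i∣ (+ L))))
    where
    D∣gcd³ : ∀ {w k x} → w ⨯ n ≡ k *³ x → ∣ k ∣ ≡ L → D ℕ.∣ L ℕ.* gcd³ x
    D∣gcd³ {w} {k} {x} eq ∣k∣≡L = subst (D ℕ.∣_) (trans (gcd³-*³ k x) (cong (ℕ._* gcd³ x) ∣k∣≡L))
                                         (gcd³-greatest _ (subst (+ D ∣³_) eq (∣³-⨯ʳ w n (gcd³∣³ n))))
    gcd[Ld,Ld']≡L : gcd (L ℕ.* d) (L ℕ.* d') ≡ L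
    gcd[Ld,Ld']≡L = trans (sym (c*gcd[m,n]≡gcd[cm,cn] L d d')) (trans (cong (L ℕ.*_) coprime) (ℕ.*-identityʳ L))

  opaque
    e k m h m' : ℕ
    e  = ℕ._∣_.quotient d∣D
    k  = ℕ._∣_.quotient D∣L
    m  = k ℕ.* e
    h  = k ℕ.* d
    m' = ℕ._∣_.quotient d'∣L

    D≡e*d : D ≡ e ℕ.* d
    D≡e*d = ℕ._∣_.equality d∣D

    L≡d*m : L ≡ d ℕ.* m
    L≡d*m = trans (ℕ._∣_.equality D∣L) (trans (cong (k ℕ.*_) D≡e*d) (rearrange k e d))
      where rearrange : ∀ k e d → k ℕ.* (e ℕ.* d) ≡ d ℕ.* (k ℕ.* e)
            rearrange = solve-∀ℕ

    L≡e*h : L ≡ e ℕ.* h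
    L≡e*h = trans (ℕ._∣_.equality D∣L) (trans (cong (k ℕ.*_) D≡e*d) (rearrange k e d))
      where rearrange : ∀ k e d → k ℕ.* (e ℕ.* d) ≡ e ℕ.* (k ℕ.* d)
            rearrange = solve-∀ℕ

    L≡d'*m' : L ≡ d' ℕ.* m'
    L≡d'*m' = trans (ℕ._∣_.equality d'∣L) (ℕ.*-comm m' d')

  private
    nonZero-factorˡ : ∀ x y → L ≡ x ℕ.* y → NonZero x
    nonZero-factorˡ x y eq = ℕ.m*n≢0⇒m≢0 x {{subst NonZero eq L≢0}}
    nonZero-factorʳ : ∀ x y → L ≡ x ℕ.* y → NonZero y
    nonZero-factorʳ x y eq = ℕ.m*n≢0⇒n≢0 x {{subst NonZero eq L≢0}}

  instance
    d≢0 : NonZero d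
    d≢0 = nonZero-factorˡ d m L≡d*m
    d'≢0 : NonZero d'
    d'≢0 = nonZero-factorˡ d' m' L≡d'*m'
    e≢0 : NonZero e
    e≢0 = nonZero-factorˡ e h L≡e*h
    h≢0 : NonZero h
    h≢0 = nonZero-factorʳ e h L≡e*h
    m'≢0 : NonZero m'
    m'≢0 = nonZero-factorʳ d' m' L≡d'*m'
    m≢0 : NonZero m
    m≢0 = nonZero-factorʳ d m L≡d*m

  opaque
    u₀ : ℤ³
    u₀ = proj₁ (∣³-quotient u (gcd³∣³ u))

    u≡d*u₀ : u ≡ (+ d) *³ u₀
    u≡d*u₀ = proj₂ (∣³-quotient u (gcd³∣³ u))

  gcd³u₀≡1 : gcd³ u₀ ≡ 1
  gcd³u₀≡1 = ℕ.*-cancelˡ-≡ (gcd³ u₀) 1 d (begin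
    d ℕ.* gcd³ u₀            ≡⟨ sym (gcd³-*³ (+ d) u₀) ⟩
    gcd³ ((+ d) *³ u₀)       ≡⟨ cong gcd³ (sym u≡d*u₀) ⟩
    d                        ≡⟨ sym (ℕ.*-identityʳ d) ⟩
    d ℕ.* 1                  ∎)

  dot-u₀ : ∀ {x} → dot u x ≡ + 0 → dot u₀ x ≡ + 0
  dot-u₀ {x} u⊥x = ℤ.*-cancelˡ-≡ (+ d) _ _ (begin
    + d * dot u₀ x          ≡⟨ sym (dot-*³ˡ (+ d) u₀ x) ⟩
    dot ((+ d) *³ u₀) x     ≡⟨ cong (λ y → dot y x) (sym u≡d*u₀) ⟩
    dot u x                 ≡⟨ u⊥x ⟩
    + 0                     ≡⟨ sym (ℤ.*-zeroʳ (+ d)) ⟩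
    + d * + 0               ∎)

  w : ℤ³
  w = v ⨯ u₀

  d*w≡v⨯u : (+ d) *³ w ≡ v ⨯ u
  d*w≡v⨯u = trans (sym (⨯-*³ʳ (+ d) v u₀)) (cong (v ⨯_) (sym u≡d*u₀))

  gcd³w≡e : gcd³ w ≡ e
  gcd³w≡e = ℕ.*-cancelˡ-≡ (gcd³ w) e d (begin
    d ℕ.* gcd³ w             ≡⟨ sym (gcd³-*³ (+ d) w) ⟩
    gcd³ ((+ d) *³ w)        ≡⟨ cong gcd³ (trans d*w≡v⨯u (⨯-anticomm u v)) ⟩
    gcd³ (-1ℤ *³ n)          ≡⟨ gcd³-*³ -1ℤ n ⟩
    1 ℕ.* D                  ≡⟨ trans (ℕ.*-identityˡ D) D≡e*d ⟩
    e ℕ.* d                  ≡⟨ ℕ.*-comm e d ⟩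
    d ℕ.* e                  ∎)

  L∣[K*m]*u : ∀ K → + L ∣³ (K * + m) *³ u
  L∣[K*m]*u K = Equivalence.from (∣³-*³⇔ (K * + m) u L≡d*m) (∣n⇒∣m*n K ∣-refl)

  admissible-shift : ∀ K P Q → Admissible (P + K * + m) Q ⇔ Admissible P Q
  admissible-shift K P Q = mk⇔
    (λ adm → ∣³-+-cancelˡ _ _ (subst (+ L ∣³_) split adm) (L∣[K*m]*u K))
    (λ adm → subst (+ L ∣³_) (sym split) (∣³-+ _ _ (L∣[K*m]*u K) adm))
    where split = *³-+-split P (K * + m) Q u v

  admissible-periodic : ∀ p q → Admissible (+ (m ℕ.+ p)) (+ q) ⇔ Admissible (+ p) (+ q)
  admissible-periodic p q = subst (λ P → Admissible P (+ q) ⇔ Admissible (+ p) (+ q)) (sym m+p) (admissible-shift (+ 1) (+ p) (+ q))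
    where
    m+p : + (m ℕ.+ p) ≡ + p + + 1 * + m
    m+p = trans (ℤ.pos-+ m p) (swap (+ m) (+ p))
      where swap : ∀ m p → m + p ≡ p + + 1 * m
            swap = solve-∀

  admissible-unique : ∀ p p' Q → p ℕ.< m → p' ℕ.< m → Admissible (+ p) Q → Admissible (+ p') Q → p ≡ p'
  admissible-unique p p' Q p<m p'<m adm adm' = ≡-from-∣-difference p<m p'<m
    (Equivalence.to (∣³-*³⇔ (+ p - + p') u L≡d*m)
      (subst (+ L ∣³_) (*³-+³-difference (+ p) (+ p') Q u v) (∣³--³ _ _ adm adm')))

  -- Crossing with u₀ kills the u-part, leaving Q·w with gcd³ w = e = L/h.
  admissible⇒h∣ : ∀ P Q → Admissible P Q → + h ∣ Q
  admissible⇒h∣ P Q adm = Equivalence.to (∣³-*³⇔ Q w {{gcd³w≢0}} L≡gcd³w*h) (subst (+ L ∣³_) crossed (∣³-⨯ˡ _ u₀ adm))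
    where
    crossed : (P *³ u +³ Q *³ v) ⨯ u₀ ≡ Q *³ w
    crossed = trans (cong (λ y → (P *³ y +³ Q *³ v) ⨯ u₀) u≡d*u₀) (⨯-parallelˡ P Q (+ d) u₀ v)
    L≡gcd³w*h : L ≡ gcd³ w ℕ.* h
    L≡gcd³w*h = trans L≡e*h (cong (ℕ._* h) (sym gcd³w≡e))
    gcd³w≢0 : NonZero (gcd³ w)
    gcd³w≢0 = subst NonZero (sym gcd³w≡e) e≢0

  admissible-on-axis : ∀ Q → Admissible (+ 0) Q ⇔ (+ m' ∣ Q)
  admissible-on-axis Q = subst (λ y → (+ L ∣³ y) ⇔ (+ m' ∣ Q)) (sym (*³-+³-zeroˡ Q u v)) (∣³-*³⇔ Q v L≡d'*m')

  module _ (y₀ w₀ : ℤ³) (y₀·u₀≡1 : dot y₀ u₀ ≡ + 1) (w≡e*w₀ : w ≡ (+ e) *³ w₀) where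

    e*[y·v]≡e*h : + e * dot (y₀ ⨯ w₀) v ≡ + e * + h
    e*[y·v]≡e*h = begin
      + e * dot (y₀ ⨯ w₀) v                    ≡⟨ cross-bézout (+ e) y₀ u₀ v w₀ y₀·u₀≡1 w≡e*w₀ v ⟩
      + 1 * dot v v - dot y₀ v * dot u₀ v      ≡⟨ cong₂ (λ α β → + 1 * α - dot y₀ v * β) |v|²≡L (dot-u₀ u⊥v) ⟩
      + 1 * + L - dot y₀ v * + 0               ≡⟨ simplify (dot y₀ v) (+ L) ⟩
      + L                                      ≡⟨ cong +_ L≡e*h ⟩
      + (e ℕ.* h)                              ≡⟨ ℤ.pos-* e h ⟩
      + e * + h                                ∎
      where simplify : ∀ c L → + 1 * L - c * + 0 ≡ L
            simplify = solve-∀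

    e*[y·n]≡0 : + e * dot (y₀ ⨯ w₀) n ≡ + e * + 0
    e*[y·n]≡0 = begin
      + e * dot (y₀ ⨯ w₀) n                    ≡⟨ cross-bézout (+ e) y₀ u₀ v w₀ y₀·u₀≡1 w≡e*w₀ n ⟩
      + 1 * dot v n - dot y₀ v * dot u₀ n      ≡⟨ cong₂ (λ α β → + 1 * α - dot y₀ v * β) (dot-⨯ʳ u v) (dot-u₀ (dot-⨯ˡ u v)) ⟩
      + 1 * + 0 - dot y₀ v * + 0               ≡⟨ simplify (dot y₀ v) (+ e) ⟩
      + e * + 0                                ∎
      where simplify : ∀ c e → + 1 * + 0 - c * + 0 ≡ e * + 0
            simplify = solve-∀

  -- y₀·u₀ = 1 by Bézout and w = e·w₀; then e·(y₀ × w₀) = v − (y₀·v) u₀.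
  plane-point : ∃ λ y → dot y n ≡ + 0 × dot y v ≡ + h
  plane-point = y₀ ⨯ w₀ , ℤ.*-cancelˡ-≡ (+ e) _ _ (e*[y·n]≡0 y₀ w₀ y₀·u₀≡1 w≡e*w₀) ,
                          ℤ.*-cancelˡ-≡ (+ e) _ _ (e*[y·v]≡e*h y₀ w₀ y₀·u₀≡1 w≡e*w₀)
    where
    y₀ = proj₁ (bézout³ u₀ gcd³u₀≡1)
    y₀·u₀≡1 = proj₂ (bézout³ u₀ gcd³u₀≡1)
    e∣³w = subst (λ g → + g ∣³ w) gcd³w≡e (gcd³∣³ w)
    w₀ = proj₁ (∣³-quotient w e∣³w)
    w≡e*w₀ = proj₂ (∣³-quotient w e∣³w)

  admissible-exists : ∀ q → h ℕ.∣ q → ∃ λ p → p ℕ.< m × Admissible (+ p) (+ q)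
  admissible-exists .(j ℕ.* h) (ℕ.divides j refl) =
    P %ℕ m , n%ℕd<d P m , Equivalence.to (admissible-shift (P /ℕ m) (+ (P %ℕ m)) (+ (j ℕ.* h)))
                                         (subst (λ P′ → Admissible P′ (+ (j ℕ.* h))) (a≡a%ℕn+[a/ℕn]*n P m) admissible-P)
    where
    y = proj₁ plane-point
    Y = (+ j) *³ y
    P = dot Y u
    Y⊥n : dot Y n ≡ + 0
    Y⊥n = trans (dot-*³ˡ (+ j) y n) (trans (cong (+ j *_) (proj₁ (proj₂ plane-point))) (ℤ.*-zeroʳ (+ j)))
    Y·v : dot Y v ≡ + (j ℕ.* h)
    Y·v = trans (dot-*³ˡ (+ j) y v) (trans (cong (+ j *_) (proj₂ (proj₂ plane-point))) (sym (ℤ.pos-* j h)))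
    admissible-P : Admissible P (+ (j ℕ.* h))
    admissible-P = subst (Admissible P) Y·v (admissible-in-plane Y Y⊥n)

  lattice-point-count : ∀ t → sum< (λ q → count< (λ p → admissible? p q) (suc (t ℕ.* L))) (suc (t ℕ.* L)) ≡
                              D ℕ.* t ℕ.^ 2 ℕ.+ (d ℕ.+ d') ℕ.* t ℕ.+ 1
  lattice-point-count t = begin
    sum< (λ q → count< (λ p → admissible? p q) (suc (t ℕ.* L))) (suc (t ℕ.* L))
      ≡⟨ box-count admissible? {m} {h} {m'} admissible-periodic
           (λ p p' q → admissible-unique p p' (+ q)) admissible-exists
           (λ p q adm → ∣⇒∣ᵤ (admissible⇒h∣ (+ p) (+ q) adm))
           (λ q → mk⇔ (λ adm → ∣⇒∣ᵤ (Equivalence.to (admissible-on-axis (+ q)) adm))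
                      (λ m'∣q → Equivalence.from (admissible-on-axis (+ q)) (∣ᵤ⇒∣ m'∣q)))
           (t ℕ.* d) (t ℕ.* e) (t ℕ.* d') (multiple L≡d*m) (multiple L≡e*h) (multiple L≡d'*m') ⟩
    t ℕ.* d ℕ.* (t ℕ.* e ℕ.+ 1) ℕ.+ (t ℕ.* d' ℕ.+ 1)
      ≡⟨ expand t d e d' ⟩
    e ℕ.* d ℕ.* t ℕ.^ 2 ℕ.+ (d ℕ.+ d') ℕ.* t ℕ.+ 1
      ≡⟨ cong (λ D → D ℕ.* t ℕ.^ 2 ℕ.+ (d ℕ.+ d') ℕ.* t ℕ.+ 1) (sym D≡e*d) ⟩
    D ℕ.* t ℕ.^ 2 ℕ.+ (d ℕ.+ d') ℕ.* t ℕ.+ 1 ∎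
    where
    multiple : ∀ {a b} → L ≡ a ℕ.* b → t ℕ.* L ≡ t ℕ.* a ℕ.* b
    multiple {a} {b} L≡ab = trans (cong (t ℕ.*_) L≡ab) (sym (ℕ.*-assoc t a b))
    expand : ∀ t d e d' → t ℕ.* d ℕ.* (t ℕ.* e ℕ.+ 1) ℕ.+ (t ℕ.* d' ℕ.+ 1) ≡ e ℕ.* d ℕ.* (t ℕ.* (t ℕ.* 1)) ℕ.+ (d ℕ.+ d') ℕ.* t ℕ.+ 1
    expand = solve-∀ℕ

  box-of-coordinates : ∀ t x s r → 0ℚ ℚ.≤ s → s ℚ.≤ 1ℚ → 0ℚ ℚ.≤ r → r ℚ.≤ 1ℚ →
    (∀ z → toℚ (dot x z) ≡ toℚ (+ t) ℚ.* (s ℚ.* toℚ (dot u z) ℚ.+ r ℚ.* toℚ (dot v z))) → InBox (t ℕ.* L) x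
  box-of-coordinates t x s r 0≤s s≤1 0≤r r≤1 dot-x =
    toℚ-injective (trans (dot-x n) (trans (cong₂ (λ P Q → T ℚ.* (s ℚ.* toℚ P ℚ.+ r ℚ.* toℚ Q)) (dot-⨯ˡ u v) (dot-⨯ʳ u v)) (zeros T s r))) ,
    in-range s 0≤s s≤1 (trans (dot-x u) (trans (cong₂ (λ P Q → T ℚ.* (s ℚ.* toℚ P ℚ.+ r ℚ.* toℚ Q)) |u|²≡L v⊥u) (first T s r (toℚ (+ L))))) ,
    in-range r 0≤r r≤1 (trans (dot-x v) (trans (cong₂ (λ P Q → T ℚ.* (s ℚ.* toℚ P ℚ.+ r ℚ.* toℚ Q)) u⊥v |v|²≡L) (second T s r (toℚ (+ L)))))
    where
    T = toℚ (+ t)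
    zeros : ∀ T s r → T ℚ.* (s ℚ.* 0ℚ ℚ.+ r ℚ.* 0ℚ) ≡ 0ℚ
    zeros = solve-∀ℚ ℚ-ring
    first : ∀ T s r L → T ℚ.* (s ℚ.* L ℚ.+ r ℚ.* 0ℚ) ≡ T ℚ.* (s ℚ.* L)
    first = solve-∀ℚ ℚ-ring
    second : ∀ T s r L → T ℚ.* (s ℚ.* 0ℚ ℚ.+ r ℚ.* L) ≡ T ℚ.* (r ℚ.* L)
    second = solve-∀ℚ ℚ-ring
    in-range : ∀ γ {z} → 0ℚ ℚ.≤ γ → γ ℚ.≤ 1ℚ → toℚ z ≡ T ℚ.* (γ ℚ.* toℚ (+ L)) → + 0 ≤ z × z ≤ + (t ℕ.* L)
    in-range γ {z} 0≤γ γ≤1 z≡TγL =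
      toℚ-cancel-≤ (subst (0ℚ ℚ.≤_) (sym z≡TγL) (0≤* (toℚ-nonNeg t) (0≤* 0≤γ (toℚ-nonNeg L)))) ,
      toℚ-cancel-≤ (subst₂ ℚ._≤_ (sym z≡TγL) (trans (sym (toℚ-* (+ t) (+ L))) (cong toℚ (sym (ℤ.pos-* t L))))
                     (*-monoˡ-≤ (toℚ-nonNeg t) (subst (γ ℚ.* toℚ (+ L) ℚ.≤_) (ℚ.*-identityˡ (toℚ (+ L)))
                                                       (*-monoʳ-≤ (toℚ-nonNeg L) γ≤1))))

  in-dilate⇒in-box : ∀ t x → InDilate t (InSquare u v) (ι x) → InBox (t ℕ.* L) x
  in-dilate⇒in-box t x (y , y∈S , x≡t*y) =
    let s , r , (0≤s , s≤1) , (0≤r , r≤1) , y≡ = Equivalence.to (in-square⇔ u v y) y∈S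
    in box-of-coordinates t x s r 0≤s s≤1 0≤r r≤1 (toℚ-dot-dilated (toℚ (+ t)) s r x u v (trans x≡t*y (cong (toℚ (+ t) ⊙_) y≡)))

  in-box⇒in-dilate : ∀ t x → InBox (t ℕ.* L) x → InDilate t (InSquare u v) (ι x)
  in-box⇒in-dilate t x x∈box =
    let p , q , p≤N , q≤N , adm , x≡point = Equivalence.from (in-grid⇔in-box (t ℕ.* L) x) x∈box
        s , r , s∈[0,1] , r∈[0,1] , ιx≡ = dilate-of-combination t L p q (point p q) u v (ℕ.≤-pred p≤N) (ℕ.≤-pred q≤N) (/³-exact L _ adm)
    in subst (λ y → InDilate t (InSquare u v) (ι y)) (sym x≡point)
             ((s ⊙ ι u) ⊕ (r ⊙ ι v) , Equivalence.from (in-square⇔ u v _) (s , r , s∈[0,1] , r∈[0,1] , refl) , ιx≡)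

  in-box⇔in-dilate : ∀ t x → InBox (t ℕ.* L) x ⇔ InDilate t (InSquare u v) (ι x)
  in-box⇔in-dilate t x = mk⇔ (in-box⇒in-dilate t x) (in-dilate⇒in-box t x)

open import Data.Nat using (ℕ; suc; _+_; _*_; _^_)
open import Data.Integer using (+_; _>_)
open import Function.Construct.Composition using (_⇔-∘_)
open import Data.List using (length)
open ≡-Reasoning

theorem2p2 : (u v : ℤ³) →
    dot u u ≡ dot v v → dot u u > + 0 → dot u v ≡ + 0 → gcd⁶ u v ≡ 1 →
    (t : ℕ) →
    LatticeCount (InSquare u v) t
      (gcd³ (cross u v) * t ^ 2 + (gcd³ u + gcd³ v) * t + 1)
theorem2p2 u v |u|²≡|v|² |u|²>0 u⊥v coprime t =
  Grid.rows N (suc N) , Grid.rows-unique N (suc N) ,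
  (λ x → in-box⇔in-dilate t x ⇔-∘ (in-grid⇔in-box N x ⇔-∘ Grid.∈-rows⇔ N (suc N) x)) ,
  (begin
    length (Grid.rows N (suc N))                                  ≡⟨ Grid.length-rows N (suc N) ⟩
    _                                                             ≡⟨ lattice-point-count t ⟩
    D * t ^ 2 + (gcd³ u + gcd³ v) * t + 1                         ≡⟨ cong (λ k → k * t ^ 2 + (gcd³ u + gcd³ v) * t + 1) (sym (VectorDivisibility.gcd³-cross u v)) ⟩
    gcd³ (cross u v) * t ^ 2 + (gcd³ u + gcd³ v) * t + 1          ∎)
  where
  open Square u v |u|²≡|v|² |u|²>0 u⊥v coprime
  N = t * L
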